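{- Let $n\geq 6$ and let $G_0$ be a properly labeled $n$-starter on vertex set $[n]$. For $l=1,2,\dots,n-1$, let $G_l$ be the graph obtained from $G_0$ by deleting the edges $\{n,n-1\},\{n,n-2\},\dots,\{n,n-l\}$. Then for every $l\in[n-1]$, $\phi(G_l)=\phi(G_{l-1})-\alpha_l$, where $\alpha_l=n-l-3$ for $l=1,2,\dots,\lceil(n-2)/2\rceil$ and $\alpha_l=n-l-2$ for $l=\lceil(n-2)/2\rceil+1,\dots,n-1$. Moreover, the graphs $G_1,\dots,G_{n-3}$ are T-graphs.
   Context: An $n$-starter is a graph $G$ on $n$ vertices whose complement $\overline G$ is a forest with $\lceil (n-2)/2\rceil$ edges. An $n$-starter $G$ on $[n]$ is properly labeled if (i) $n$ is an isolated vertex of $\overline G$, and (ii) for $i=1,\dots,\lceil (n-2)/2\rceil$, the vertex $n-i$ has degree 1 in $\overline G-\{n,n-1,\dots,n-i+1\}$. For a graph $H$ on $n$ vertices, $\phi(H)=\binom{n}{3}-(n-3)e(\overline H)+e(L(\overline H))-t(\overline H)$, where $e$ counts edges, $t$ counts triangles, $\overline H$ is the complement and $L$ denotes the line graph. A T-graph is a graph in which every edge lies in a triangle. -}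

module Defs where

open import Data.Bool using (Bool; true; false; _∧_; _∨_; not)
open import Data.Nat using (ℕ; zero; suc; _∸_; _≤_; _≡ᵇ_; _<ᵇ_; _≤ᵇ_; ⌈_/2⌉)
open import Data.Nat.Combinatorics using (_C_)
open import Data.Integer as ℤ using (ℤ; +_)
open import Data.Fin using (Fin; toℕ; inject₁; fromℕ; _≟_)
import Data.Fin as F
open import Data.Empty using (⊥)
open import Data.Nat as N using ()
open import Data.List using (List; []; _∷_; length; map; filterᵇ; concatMap; _++_; allFin)
open import Data.Product using (Σ; _×_; _,_; ∃)
open import Relation.Binary.PropositionalEquality using (_≡_)
open import Relation.Nullary.Decidable using (⌊_⌋)
open import Function.Definitions using (Injective)

-- A graph on the vertex set Fin n (vertex with label k ∈ [n] is the
-- element of Fin n with toℕ = k - 1), given by its adjacency relation.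
Adj : ℕ → Set
Adj n = Fin n → Fin n → Bool

record IsSimple {n : ℕ} (A : Adj n) : Set where
  field
    symm   : ∀ u v → A u v ≡ A v u
    irrefl : ∀ v → A v v ≡ false

_==_ : {n : ℕ} → Fin n → Fin n → Bool
u == v = ⌊ u ≟ v ⌋

compl : {n : ℕ} → Adj n → Adj n
compl A u v = not (A u v) ∧ not (u == v)

count : {X : Set} → (X → Bool) → List X → ℕ
count p xs = length (filterᵇ p xs)

pairs : (n : ℕ) → List (Fin n × Fin n)
pairs n = concatMap (λ i → map (λ j → (i , j)) (filterᵇ (λ j → toℕ i <ᵇ toℕ j) (allFin n))) (allFin n)

triples : (n : ℕ) → List (Fin n × Fin n × Fin n)
triples n = concatMap (λ { (i , j) → map (λ k → (i , j , k)) (filterᵇ (λ k → toℕ j <ᵇ toℕ k) (allFin n)) }) (pairs n)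

edges : {n : ℕ} → Adj n → List (Fin n × Fin n)
edges {n} A = filterᵇ (λ { (i , j) → A i j }) (pairs n)

e : {n : ℕ} → Adj n → ℕ
e A = length (edges A)

t : {n : ℕ} → Adj n → ℕ
t {n} A = count (λ { (i , j , k) → A i j ∧ A j k ∧ A i k }) (triples n)

listPairs : {X : Set} → List X → List (X × X)
listPairs [] = []
listPairs (x ∷ xs) = map (λ y → (x , y)) xs ++ listPairs xs

shareVertex : {n : ℕ} → (Fin n × Fin n) → (Fin n × Fin n) → Bool
shareVertex (a , b) (c , d) = (a == c) ∨ (a == d) ∨ (b == c) ∨ (b == d)

-- number of edges of the line graph L(A): unordered pairs of distinct edges
-- of A sharing an endpoint
eLine : {n : ℕ} → Adj n → ℕ
eLine A = count (λ { (f , g) → shareVertex f g }) (listPairs (edges A))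

φ : {n : ℕ} → Adj n → ℤ
φ {n} H = ((+ (n C 3) ℤ.- (+ (n ∸ 3)) ℤ.* (+ e (compl H))) ℤ.+ (+ eLine (compl H))) ℤ.- (+ t (compl H))

HasCycle : {n : ℕ} → Adj n → Set
HasCycle {n} A =
  Σ ℕ λ k → Σ (Fin (suc (suc (suc k))) → Fin n) λ f →
    Injective _≡_ _≡_ f
    × (∀ (i : Fin (suc (suc k))) → A (f (inject₁ i)) (f (F.suc i)) ≡ true)
    × (A (f (fromℕ (suc (suc k)))) (f F.zero) ≡ true)

IsForest : {n : ℕ} → Adj n → Set
IsForest A = HasCycle A → ⊥

m : ℕ → ℕ
m n = ⌈ (n ∸ 2) /2⌉

IsStarter : {n : ℕ} → Adj n → Set
IsStarter {n} G = IsSimple G × IsForest (compl G) × (e (compl G) ≡ m n)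

-- degree of v in A restricted to the vertices with toℕ < b
-- (i.e. in A minus the vertices with labels b+1, …, n)
degBelow : {n : ℕ} → Adj n → ℕ → Fin n → ℕ
degBelow {n} A b v = count (λ u → A v u ∧ (toℕ u <ᵇ b)) (allFin n)

deg : {n : ℕ} → Adj n → Fin n → ℕ
deg {n} A v = count (λ u → A v u) (allFin n)

IsProperlyLabeled : {n : ℕ} → Adj n → Set
IsProperlyLabeled {n} G =
  IsStarter G
  × (∀ (v : Fin n) → toℕ v ≡ n ∸ 1 → deg (compl G) v ≡ 0)
  × (∀ (i : ℕ) → 1 ≤ i → i ≤ m n →
       ∀ (v : Fin n) → toℕ v ≡ n ∸ i ∸ 1 →
         degBelow (compl G) (n ∸ i ∸ 1 N.+ 1) v ≡ 1)

-- G_l : delete the edges {n, n-1}, …, {n, n-l} from G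
-- (label n ↦ index n-1; labels n-l..n-1 ↦ indices n-1-l..n-2)
delIdx : (n l : ℕ) → ℕ → ℕ → Bool
delIdx n l a b = (a ≡ᵇ (n ∸ 1)) ∧ ((n ∸ 1 ∸ l) ≤ᵇ b) ∧ (b <ᵇ (n ∸ 1))

Gl : {n : ℕ} → Adj n → ℕ → Adj n
Gl {n} G l u v = G u v ∧ not (delIdx n l (toℕ u) (toℕ v) ∨ delIdx n l (toℕ v) (toℕ u))

IsTGraph : {n : ℕ} → Adj n → Set
IsTGraph {n} A = ∀ u v → A u v ≡ true → ∃ λ w → (A u w ≡ true) × (A v w ≡ true)

α : ℕ → ℕ → ℤ
α n l with l N.≤ᵇ m n
... | true  = (+ n ℤ.- + l) ℤ.- + 3
... | false = (+ n ℤ.- + l) ℤ.- + 2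

module Submission where

-- Let F be the complement forest of G and count every F-edge at its upper endpoint. Proper
-- labelling gives lower degree 1 to the M = ⌈(n-2)/2⌉ vertices labelled n-M, …, n-1; as F has
-- only M edges, all other lower degrees vanish. Hence every F-edge has its upper end at a label
-- ≥ 4, every vertex has at most one lower F-neighbour, and n is isolated in F.
--
-- G_l arises from G_(l-1) by adding the edge {n-l, n} to the complement A. Adding an edge ab to A
-- raises e by 1, e(L(A)) by deg a + deg b and t by the number of common neighbours of a and b,
-- so φ drops by (n-3) - deg a - deg b + codeg(a,b). In A, n is adjacent to n-l+1, …, n-1 and
-- n-l to its lower F-neighbour (present iff l ≤ M) and to its upper F-neighbours, which are
-- exactly the common neighbours; this leaves α_l.
--
-- For the T-graph property, each vertex equals or is F-adjacent to at most one of the vertices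
-- labelled 1, 2, 3, so two vertices other than n have a common neighbour among them, and an edge
-- at n has one among the labels 1, 2, which stay adjacent to n while l ≤ n-3.

open import Defs
open import Data.Bool using (Bool; true; false; _∧_; _∨_; not; if_then_else_)
open import Data.Bool.Properties using (∨-comm; ∨-identityʳ; ∨-zeroʳ; ∧-comm; ∧-zeroʳ; ∧-identityʳ; ∧-distribˡ-∨)
open import Data.Empty using (⊥; ⊥-elim)
open import Data.Fin using (Fin; toℕ; _≟_; fromℕ; fromℕ<; punchIn; punchOut) renaming (zero to fzero; suc to fsuc)
open import Data.Fin.Properties using (toℕ-injective; toℕ-fromℕ; toℕ-fromℕ<; toℕ<n; punchInᵢ≢i; punchIn-punchOut)
open import Data.Integer using (_-_)
import Data.Integer as ℤ
import Data.Integer.Properties as ℤ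
import Data.Integer.Tactic.RingSolver as ℤ-Solver
open import Data.List using (List; []; _∷_; map; filterᵇ; concatMap; _++_; allFin; tabulate)
open import Data.Nat as ℕ using (ℕ; zero; suc; _+_; _*_; _∸_; _≤_; _<_; _≡ᵇ_; _<ᵇ_; _≤ᵇ_; z≤n; s≤s; _<?_; _≤?_)
open import Data.Nat.Combinatorics using () renaming (_C_ to _choose_)
open import Data.Nat.Properties hiding (_≟_)
open import Data.Nat.Tactic.RingSolver using (solve-∀)
open import Algebra.Properties.CommutativeMonoid.Sum +-0-commutativeMonoid
  using (sum; sum-cong-≗; sum-replicate-zero; ∑-distrib-+; ∑-comm; sum-remove)
open import Data.Product using (Σ; _×_; _,_; proj₁; proj₂)
open import Data.Sum using (_⊎_; inj₁; inj₂)
open import Relation.Binary.Definitions using (tri<; tri≈; tri>)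
open import Relation.Binary.PropositionalEquality
open import Relation.Nullary using (yes; no; ¬_; Dec; does)
open import Relation.Nullary.Decidable using (dec-true; dec-false)

⟦_⟧ : Bool → ℕ
⟦ true ⟧ = 1
⟦ false ⟧ = 0

⟦⟧≡0⇒false : ∀ b → ⟦ b ⟧ ≡ 0 → b ≡ false
⟦⟧≡0⇒false false _ = refl

if-0 : (b : Bool) → (if b then 0 else 0) ≡ 0
if-0 true = refl
if-0 false = refl

if-+ : (b : Bool) (x y : ℕ) → (if b then x + y else 0) ≡ (if b then x else 0) + (if b then y else 0)
if-+ true x y = refl
if-+ false x y = refl

does-true : {A : Set} (a? : Dec A) → does a? ≡ true → A
does-true (yes a) _ = a

true≢false : true ≡ false → ⊥
true≢false ()

∧-true⇒ : ∀ {x y} → (x ∧ y) ≡ true → (x ≡ true) × (y ≡ true)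
∧-true⇒ {true} {true} _ = refl , refl

<ᵇ-suc : ∀ m n → (m <ᵇ suc n) ≡ (m ≤ᵇ n)
<ᵇ-suc zero n = refl
<ᵇ-suc (suc m) n = refl

≡ᵇ-refl : ∀ m → (m ≡ᵇ m) ≡ true
≡ᵇ-refl m = dec-true (m ℕ.≟ m) refl

≡ᵇ-false : ∀ {m n} → m ≢ n → (m ≡ᵇ n) ≡ false
≡ᵇ-false {m} {n} = dec-false (m ℕ.≟ n)

<ᵇ-true : ∀ {m n} → m < n → (m <ᵇ n) ≡ true
<ᵇ-true {m} {n} = dec-true (m <? n)

<ᵇ-false : ∀ {m n} → ¬ m < n → (m <ᵇ n) ≡ false
<ᵇ-false {m} {n} = dec-false (m <? n)

≤ᵇ-true : ∀ {m n} → m ≤ n → (m ≤ᵇ n) ≡ true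
≤ᵇ-true {m} {n} = dec-true (m ≤? n)

≤ᵇ-false : ∀ {m n} → ¬ m ≤ n → (m ≤ᵇ n) ≡ false
≤ᵇ-false {m} {n} = dec-false (m ≤? n)

<ᵇ-sound : ∀ {m n} → (m <ᵇ n) ≡ true → m < n
<ᵇ-sound {m} {n} = does-true (m <? n)

≤ᵇ-sound : ∀ {m n} → (m ≤ᵇ n) ≡ true → m ≤ n
≤ᵇ-sound {m} {n} = does-true (m ≤? n)

n<ᵇn : ∀ n → (n <ᵇ n) ≡ false
n<ᵇn n = <ᵇ-false (n≮n n)

≤ᵇ-≢ : ∀ {x y} → x ≢ y → (x ≤ᵇ y) ≡ (x <ᵇ y)
≤ᵇ-≢ {x} {y} x≢y with <-cmp x y
... | tri< x<y _ _ = trans (≤ᵇ-true (<⇒≤ x<y)) (sym (<ᵇ-true x<y))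
... | tri≈ _ x≡y _ = ⊥-elim (x≢y x≡y)
... | tri> _ _ y<x = trans (≤ᵇ-false (<⇒≱ y<x)) (sym (<ᵇ-false (<-asym y<x)))

∑ₗ : {X : Set} → List X → (X → ℕ) → ℕ
∑ₗ [] f = 0
∑ₗ (x ∷ xs) f = f x + ∑ₗ xs f

count≡∑ₗ : {X : Set} (p : X → Bool) (xs : List X) → count p xs ≡ ∑ₗ xs (λ x → ⟦ p x ⟧)
count≡∑ₗ p [] = refl
count≡∑ₗ p (x ∷ xs) with p x
... | true = cong suc (count≡∑ₗ p xs)
... | false = count≡∑ₗ p xs

∑ₗ-cong : {X : Set} (xs : List X) {f g : X → ℕ} → (∀ x → f x ≡ g x) → ∑ₗ xs f ≡ ∑ₗ xs g
∑ₗ-cong [] h = refl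
∑ₗ-cong (x ∷ xs) h = cong₂ _+_ (h x) (∑ₗ-cong xs h)

∑ₗ-zero : {X : Set} (xs : List X) → ∑ₗ xs (λ _ → 0) ≡ 0
∑ₗ-zero [] = refl
∑ₗ-zero (x ∷ xs) = ∑ₗ-zero xs

∑ₗ-if : {X : Set} (xs : List X) (b : Bool) (f : X → ℕ) → ∑ₗ xs (λ x → if b then f x else 0) ≡ (if b then ∑ₗ xs f else 0)
∑ₗ-if xs true f = refl
∑ₗ-if xs false f = ∑ₗ-zero xs

∑ₗ-distrib-+ : {X : Set} (xs : List X) (f g : X → ℕ) → ∑ₗ xs (λ x → f x + g x) ≡ ∑ₗ xs f + ∑ₗ xs g
∑ₗ-distrib-+ [] f g = refl
∑ₗ-distrib-+ (x ∷ xs) f g rewrite ∑ₗ-distrib-+ xs f g = +-exchange (f x) (g x) (∑ₗ xs f) (∑ₗ xs g)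
  where
  +-exchange : ∀ a b c d → (a + b) + (c + d) ≡ (a + c) + (b + d)
  +-exchange = solve-∀

∑ₗ-++ : {X : Set} (xs ys : List X) (f : X → ℕ) → ∑ₗ (xs ++ ys) f ≡ ∑ₗ xs f + ∑ₗ ys f
∑ₗ-++ [] ys f = refl
∑ₗ-++ (x ∷ xs) ys f = trans (cong (f x +_) (∑ₗ-++ xs ys f)) (sym (+-assoc (f x) _ _))

∑ₗ-map : {X Y : Set} (g : X → Y) (xs : List X) (f : Y → ℕ) → ∑ₗ (map g xs) f ≡ ∑ₗ xs (λ x → f (g x))
∑ₗ-map g [] f = refl
∑ₗ-map g (x ∷ xs) f = cong (f (g x) +_) (∑ₗ-map g xs f)

∑ₗ-concatMap : {X Y : Set} (g : X → List Y) (xs : List X) (f : Y → ℕ) →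
  ∑ₗ (concatMap g xs) f ≡ ∑ₗ xs (λ x → ∑ₗ (g x) f)
∑ₗ-concatMap g [] f = refl
∑ₗ-concatMap g (x ∷ xs) f = trans (∑ₗ-++ (g x) (concatMap g xs) f) (cong (∑ₗ (g x) f +_) (∑ₗ-concatMap g xs f))

∑ₗ-filterᵇ : {X : Set} (p : X → Bool) (xs : List X) (f : X → ℕ) →
  ∑ₗ (filterᵇ p xs) f ≡ ∑ₗ xs (λ x → if p x then f x else 0)
∑ₗ-filterᵇ p [] f = refl
∑ₗ-filterᵇ p (x ∷ xs) f with p x
... | true = cong (f x +_) (∑ₗ-filterᵇ p xs f)
... | false = ∑ₗ-filterᵇ p xs f

∑ₗ-tabulate : (n : ℕ) {X : Set} (g : Fin n → X) (f : X → ℕ) → ∑ₗ (tabulate g) f ≡ sum (λ i → f (g i))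
∑ₗ-tabulate zero g f = refl
∑ₗ-tabulate (suc n) g f = cong (f (g fzero) +_) (∑ₗ-tabulate n (λ i → g (fsuc i)) f)

∑ₗ-allFin : (n : ℕ) (f : Fin n → ℕ) → ∑ₗ (allFin n) f ≡ sum f
∑ₗ-allFin n f = ∑ₗ-tabulate n (λ i → i) f

count-allFin : (n : ℕ) (p : Fin n → Bool) → count p (allFin n) ≡ sum (λ i → ⟦ p i ⟧)
count-allFin n p = trans (count≡∑ₗ p (allFin n)) (∑ₗ-allFin n _)

∑-zero : {n : ℕ} {f : Fin n → ℕ} → (∀ i → f i ≡ 0) → sum f ≡ 0
∑-zero {n} h = trans (sum-cong-≗ {n} h) (sum-replicate-zero n)

∑-single : {n : ℕ} (f : Fin n → ℕ) (a : Fin n) → (∀ i → i ≢ a → f i ≡ 0) → sum f ≡ f a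
∑-single {suc n} f a h = begin
    sum f
  ≡⟨ sum-remove {i = a} f ⟩
    f a + sum (λ j → f (punchIn a j))
  ≡⟨ cong (f a +_) (∑-zero (λ j → h (punchIn a j) (punchInᵢ≢i a j))) ⟩
    f a + 0
  ≡⟨ +-identityʳ (f a) ⟩
    f a ∎
  where open ≡-Reasoning

≤-∑ : {n : ℕ} (f : Fin n → ℕ) (a : Fin n) → f a ≤ sum f
≤-∑ {suc n} f a = ≤-trans (m≤m+n (f a) _) (≤-reflexive (sym (sum-remove {i = a} f)))

+≤-∑ : {n : ℕ} (f : Fin n → ℕ) {a b : Fin n} → a ≢ b → f a + f b ≤ sum f
+≤-∑ {suc n} f {a} {b} a≢b = begin
    f a + f b
  ≡⟨ cong (λ c → f a + f c) (sym (punchIn-punchOut a≢b)) ⟩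
    f a + f (punchIn a (punchOut a≢b))
  ≤⟨ +-monoʳ-≤ (f a) (≤-∑ (λ j → f (punchIn a j)) (punchOut a≢b)) ⟩
    f a + sum (λ j → f (punchIn a j))
  ≡⟨ sym (sum-remove {i = a} f) ⟩
    sum f ∎
  where open ≤-Reasoning

∑≡0⇒≡0 : {n : ℕ} (f : Fin n → ℕ) → sum f ≡ 0 → ∀ a → f a ≡ 0
∑≡0⇒≡0 f h a = n≤0⇒n≡0 (subst (f a ≤_) h (≤-∑ f a))

∑-interval : (n lo hi : ℕ) → hi ≤ n → sum (λ (i : Fin n) → ⟦ (lo ≤ᵇ toℕ i) ∧ (toℕ i <ᵇ hi) ⟧) ≡ hi ∸ lo
∑-interval n lo zero _ = trans (∑-zero {n} (λ i → below-zero lo (toℕ i))) (sym (0∸n≡0 lo))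
  where
  below-zero : ∀ lo x → ⟦ (lo ≤ᵇ x) ∧ (x <ᵇ 0) ⟧ ≡ 0
  below-zero lo x rewrite ∧-zeroʳ (lo ≤ᵇ x) = refl
∑-interval (suc n) zero (suc hi) (s≤s hi≤n) = cong suc (∑-interval n zero hi hi≤n)
∑-interval (suc n) (suc lo) (suc hi) (s≤s hi≤n) =
  trans (sum-cong-≗ {n} (λ i → cong (λ b → ⟦ b ∧ (toℕ i <ᵇ hi) ⟧) (<ᵇ-suc lo (toℕ i))))
        (∑-interval n lo hi hi≤n)

==-refl : {n : ℕ} (a : Fin n) → (a == a) ≡ true
==-refl a with a ≟ a
... | yes _ = refl
... | no a≢a = ⊥-elim (a≢a refl)

≢⇒==-false : {n : ℕ} {a b : Fin n} → a ≢ b → (a == b) ≡ false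
≢⇒==-false {a = a} {b} a≢b with a ≟ b
... | yes a≡b = ⊥-elim (a≢b a≡b)
... | no _ = refl

==-true⇒≡ : {n : ℕ} {a b : Fin n} → (a == b) ≡ true → a ≡ b
==-true⇒≡ {a = a} {b} h with a ≟ b
... | yes a≡b = a≡b

==-sym : {n : ℕ} (a b : Fin n) → (a == b) ≡ (b == a)
==-sym a b with a ≟ b
... | yes refl = sym (==-refl a)
... | no a≢b = sym (≢⇒==-false (λ b≡a → a≢b (sym b≡a)))

==-toℕ : {n : ℕ} (a b : Fin n) → (a == b) ≡ (toℕ a ≡ᵇ toℕ b)
==-toℕ a b with a ≟ b
... | yes refl = sym (≡ᵇ-refl (toℕ a))
... | no a≢b = sym (≡ᵇ-false (λ e → a≢b (toℕ-injective e)))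

_≺_ : {n : ℕ} → Fin n → Fin n → Bool
i ≺ j = toℕ i <ᵇ toℕ j

≺-irrefl : {n : ℕ} (i : Fin n) → (i ≺ i) ≡ false
≺-irrefl i = n<ᵇn (toℕ i)

≺⇒< : {n : ℕ} (i j : Fin n) → (i ≺ j) ≡ true → toℕ i < toℕ j
≺⇒< i j = <ᵇ-sound

<⇒≺ : {n : ℕ} (i j : Fin n) → toℕ i < toℕ j → (i ≺ j) ≡ true
<⇒≺ i j = <ᵇ-true

≺⇒≢ : {n : ℕ} (i j : Fin n) → (i ≺ j) ≡ true → i ≢ j
≺⇒≢ i .i i≺i refl = <-irrefl refl (≺⇒< i i i≺i)

≺-trans : {n : ℕ} (i j k : Fin n) → (i ≺ j) ≡ true → (j ≺ k) ≡ true → (i ≺ k) ≡ true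
≺-trans i j k i≺j j≺k = <⇒≺ i k (<-trans (≺⇒< i j i≺j) (≺⇒< j k j≺k))

≺-asym : {n : ℕ} (i j : Fin n) → (i ≺ j) ≡ true → (j ≺ i) ≡ false
≺-asym i j i≺j = <ᵇ-false (<-asym (≺⇒< i j i≺j))

≺-total : {n : ℕ} (i j : Fin n) → i ≢ j →
  ((i ≺ j) ≡ true × (j ≺ i) ≡ false) ⊎ ((i ≺ j) ≡ false × (j ≺ i) ≡ true)
≺-total i j i≢j with <-cmp (toℕ i) (toℕ j)
... | tri< i<j _ _ = inj₁ (<⇒≺ i j i<j , ≺-asym i j (<⇒≺ i j i<j))
... | tri≈ _ i≡j _ = ⊥-elim (i≢j (toℕ-injective i≡j))
... | tri> _ _ j<i = inj₂ (≺-asym j i (<⇒≺ j i j<i) , <⇒≺ j i j<i)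

∑ₗ-pairs : (n : ℕ) (f : Fin n × Fin n → ℕ) →
  ∑ₗ (pairs n) f ≡ sum (λ i → sum (λ j → if i ≺ j then f (i , j) else 0))
∑ₗ-pairs n f = begin
    ∑ₗ (pairs n) f
  ≡⟨ ∑ₗ-concatMap _ (allFin n) f ⟩
    ∑ₗ (allFin n) (λ i → ∑ₗ (map (i ,_) (filterᵇ (i ≺_) (allFin n))) f)
  ≡⟨ ∑ₗ-allFin n _ ⟩
    sum (λ i → ∑ₗ (map (i ,_) (filterᵇ (i ≺_) (allFin n))) f)
  ≡⟨ sum-cong-≗ {n} (λ i → trans (∑ₗ-map (i ,_) (filterᵇ (i ≺_) (allFin n)) f)
                           (trans (∑ₗ-filterᵇ (i ≺_) (allFin n) (λ j → f (i , j))) (∑ₗ-allFin n _))) ⟩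
    sum (λ i → sum (λ j → if i ≺ j then f (i , j) else 0)) ∎
  where open ≡-Reasoning

∑ₗ-pairs-cong : (n : ℕ) {f g : Fin n × Fin n → ℕ} → (∀ i j → (i ≺ j) ≡ true → f (i , j) ≡ g (i , j)) →
  ∑ₗ (pairs n) f ≡ ∑ₗ (pairs n) g
∑ₗ-pairs-cong n {f} {g} h =
  trans (∑ₗ-pairs n f) (trans (sum-cong-≗ {n} (λ i → sum-cong-≗ {n} (λ j → on-pair i j))) (sym (∑ₗ-pairs n g)))
  where
  on-pair : ∀ i j → (if i ≺ j then f (i , j) else 0) ≡ (if i ≺ j then g (i , j) else 0)
  on-pair i j with i ≺ j in i≺j
  ... | true = h i j i≺j
  ... | false = refl

∑ₗ-triples : (n : ℕ) (f : Fin n × Fin n × Fin n → ℕ) →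
  ∑ₗ (triples n) f ≡ sum (λ i → sum (λ j → if i ≺ j then sum (λ k → if j ≺ k then f (i , j , k) else 0) else 0))
∑ₗ-triples n f = begin
    ∑ₗ (triples n) f
  ≡⟨ ∑ₗ-concatMap _ (pairs n) f ⟩
    ∑ₗ (pairs n) (λ p → ∑ₗ (map (λ k → (proj₁ p , proj₂ p , k)) (filterᵇ (proj₂ p ≺_) (allFin n))) f)
  ≡⟨ ∑ₗ-pairs n _ ⟩
    sum (λ i → sum (λ j → if i ≺ j then ∑ₗ (map (λ k → (i , j , k)) (filterᵇ (j ≺_) (allFin n))) f else 0))
  ≡⟨ sum-cong-≗ {n} (λ i → sum-cong-≗ {n} (λ j → cong (λ x → if i ≺ j then x else 0)
        (trans (∑ₗ-map (λ k → (i , j , k)) (filterᵇ (j ≺_) (allFin n)) f)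
               (trans (∑ₗ-filterᵇ (j ≺_) (allFin n) (λ k → f (i , j , k))) (∑ₗ-allFin n _))))) ⟩
    sum (λ i → sum (λ j → if i ≺ j then sum (λ k → if j ≺ k then f (i , j , k) else 0) else 0)) ∎
  where open ≡-Reasoning

∑ₗ-listPairs-filterᵇ : {X : Set} (p : X → Bool) (xs : List X) (h : X × X → ℕ) →
  ∑ₗ (listPairs (filterᵇ p xs)) h ≡
  ∑ₗ (listPairs xs) (λ q → if p (proj₁ q) then (if p (proj₂ q) then h q else 0) else 0)
∑ₗ-listPairs-filterᵇ p [] h = refl
∑ₗ-listPairs-filterᵇ p (x ∷ xs) h with p x in px
... | true = begin
    ∑ₗ (map (x ,_) (filterᵇ p xs) ++ listPairs (filterᵇ p xs)) h
  ≡⟨ ∑ₗ-++ (map (x ,_) (filterᵇ p xs)) _ h ⟩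
    ∑ₗ (map (x ,_) (filterᵇ p xs)) h + ∑ₗ (listPairs (filterᵇ p xs)) h
  ≡⟨ cong₂ _+_ (trans (∑ₗ-map (x ,_) (filterᵇ p xs) h) (∑ₗ-filterᵇ p xs (λ y → h (x , y))))
               (∑ₗ-listPairs-filterᵇ p xs h) ⟩
    ∑ₗ xs (λ y → if p y then h (x , y) else 0) + ∑ₗ (listPairs xs) H
  ≡⟨ cong (_+ ∑ₗ (listPairs xs) H) (∑ₗ-cong xs (λ y → cong (λ c → if c then (if p y then h (x , y) else 0) else 0) (sym px))) ⟩
    ∑ₗ xs (λ y → H (x , y)) + ∑ₗ (listPairs xs) H
  ≡⟨ cong (_+ ∑ₗ (listPairs xs) H) (sym (∑ₗ-map (x ,_) xs H)) ⟩
    ∑ₗ (map (x ,_) xs) H + ∑ₗ (listPairs xs) H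
  ≡⟨ sym (∑ₗ-++ (map (x ,_) xs) _ H) ⟩
    ∑ₗ (map (x ,_) xs ++ listPairs xs) H ∎
  where
  open ≡-Reasoning
  H : _ → ℕ
  H q = if p (proj₁ q) then (if p (proj₂ q) then h q else 0) else 0
... | false = begin
    ∑ₗ (listPairs (filterᵇ p xs)) h
  ≡⟨ ∑ₗ-listPairs-filterᵇ p xs h ⟩
    ∑ₗ (listPairs xs) H
  ≡⟨ cong (_+ ∑ₗ (listPairs xs) H) (sym (trans (∑ₗ-map (x ,_) xs H)
       (trans (∑ₗ-cong xs (λ y → cong (λ c → if c then (if p y then h (x , y) else 0) else 0) px)) (∑ₗ-zero xs)))) ⟩
    ∑ₗ (map (x ,_) xs) H + ∑ₗ (listPairs xs) H
  ≡⟨ sym (∑ₗ-++ (map (x ,_) xs) _ H) ⟩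
    ∑ₗ (map (x ,_) xs ++ listPairs xs) H ∎
  where
  open ≡-Reasoning
  H : _ → ℕ
  H q = if p (proj₁ q) then (if p (proj₂ q) then h q else 0) else 0

∑ₗ-listPairs-double : {X : Set} (xs : List X) (h : X × X → ℕ) → (∀ x y → h (x , y) ≡ h (y , x)) →
  2 * ∑ₗ (listPairs xs) h + ∑ₗ xs (λ x → h (x , x)) ≡ ∑ₗ xs (λ x → ∑ₗ xs (λ y → h (x , y)))
∑ₗ-listPairs-double [] h h-sym = refl
∑ₗ-listPairs-double (x ∷ xs) h h-sym = begin
    2 * ∑ₗ (map (x ,_) xs ++ listPairs xs) h + (h (x , x) + ∑ₗ xs (λ z → h (z , z)))
  ≡⟨ cong (λ v → 2 * v + (h (x , x) + ∑ₗ xs (λ z → h (z , z))))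
          (trans (∑ₗ-++ (map (x ,_) xs) _ h) (cong (_+ ∑ₗ (listPairs xs) h) (∑ₗ-map (x ,_) xs h))) ⟩
    2 * (row + ∑ₗ (listPairs xs) h) + (h (x , x) + ∑ₗ xs (λ z → h (z , z)))
  ≡⟨ regroup row (∑ₗ (listPairs xs) h) (h (x , x)) (∑ₗ xs (λ z → h (z , z))) ⟩
    (h (x , x) + row) + (row + (2 * ∑ₗ (listPairs xs) h + ∑ₗ xs (λ z → h (z , z))))
  ≡⟨ cong₂ (λ u v → (h (x , x) + row) + (u + v)) (∑ₗ-cong xs (h-sym x)) (∑ₗ-listPairs-double xs h h-sym) ⟩
    (h (x , x) + row) + (∑ₗ xs (λ z → h (z , x)) + ∑ₗ xs (λ z → ∑ₗ xs (λ y → h (z , y))))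
  ≡⟨ cong ((h (x , x) + row) +_) (sym (∑ₗ-distrib-+ xs (λ z → h (z , x)) _)) ⟩
    (h (x , x) + row) + ∑ₗ xs (λ z → h (z , x) + ∑ₗ xs (λ y → h (z , y))) ∎
  where
  open ≡-Reasoning
  row = ∑ₗ xs (λ y → h (x , y))
  regroup : ∀ r l a d → 2 * (r + l) + (a + d) ≡ (a + r) + (r + (2 * l + d))
  regroup = solve-∀

isEdge : {n : ℕ} → Adj n → Fin n × Fin n → Bool
isEdge C p = C (proj₁ p) (proj₂ p)

e-as-∑ₗ : {n : ℕ} (C : Adj n) → e C ≡ ∑ₗ (pairs n) (λ p → ⟦ isEdge C p ⟧)
e-as-∑ₗ {n} C = count≡∑ₗ _ (pairs n)

deg-as-∑ₗ : {n : ℕ} (C : Adj n) → (∀ u v → C u v ≡ C v u) → (∀ v → C v v ≡ false) → (c : Fin n) →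
  deg C c ≡ ∑ₗ (pairs n) (λ p → ⟦ isEdge C p ∧ (proj₁ p == c) ⟧ + ⟦ isEdge C p ∧ (proj₂ p == c) ⟧)
deg-as-∑ₗ {n} C C-sym C-irrefl c = sym (begin
    ∑ₗ (pairs n) (λ p → ⟦ isEdge C p ∧ (proj₁ p == c) ⟧ + ⟦ isEdge C p ∧ (proj₂ p == c) ⟧)
  ≡⟨ ∑ₗ-distrib-+ (pairs n) _ _ ⟩
    ∑ₗ (pairs n) (λ p → ⟦ isEdge C p ∧ (proj₁ p == c) ⟧) + ∑ₗ (pairs n) (λ p → ⟦ isEdge C p ∧ (proj₂ p == c) ⟧)
  ≡⟨ cong₂ _+_ (∑ₗ-pairs n _) (trans (∑ₗ-pairs n _) (∑-comm {n} {n} _)) ⟩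
    sum (λ i → sum (λ j → if i ≺ j then ⟦ C i j ∧ (i == c) ⟧ else 0))
      + sum (λ j → sum (λ i → if i ≺ j then ⟦ C i j ∧ (j == c) ⟧ else 0))
  ≡⟨ cong₂ _+_ (∑-single _ c (λ i i≢c → ∑-zero {n} (λ j → off-c (i ≺ j) (C i j) i≢c)))
               (∑-single _ c (λ j j≢c → ∑-zero {n} (λ i → off-c (i ≺ j) (C i j) j≢c))) ⟩
    sum (λ j → if c ≺ j then ⟦ C c j ∧ (c == c) ⟧ else 0) + sum (λ i → if i ≺ c then ⟦ C i c ∧ (c == c) ⟧ else 0)
  ≡⟨ sym (∑-distrib-+ {n} _ _) ⟩
    sum (λ u → (if c ≺ u then ⟦ C c u ∧ (c == c) ⟧ else 0) + (if u ≺ c then ⟦ C u c ∧ (c == c) ⟧ else 0))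
  ≡⟨ sum-cong-≗ {n} at-u ⟩
    sum (λ u → ⟦ C c u ⟧)
  ≡⟨ sym (count-allFin n (C c)) ⟩
    deg C c ∎)
  where
  open ≡-Reasoning
  off-c : ∀ {x} (b d : Bool) → x ≢ c → (if b then ⟦ d ∧ (x == c) ⟧ else 0) ≡ 0
  off-c b d x≢c rewrite ≢⇒==-false x≢c | ∧-zeroʳ d = if-0 b
  at-u : ∀ u → (if c ≺ u then ⟦ C c u ∧ (c == c) ⟧ else 0) + (if u ≺ c then ⟦ C u c ∧ (c == c) ⟧ else 0) ≡ ⟦ C c u ⟧
  at-u u rewrite ==-refl c | ∧-identityʳ (C c u) | ∧-identityʳ (C u c) | C-sym u c with u ≟ c
  ... | yes refl rewrite ≺-irrefl u | C-irrefl u = refl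
  ... | no u≢c with ≺-total c u (λ c≡u → u≢c (sym c≡u))
  ...   | inj₁ (c≺u , u⊀c) rewrite c≺u | u⊀c = +-identityʳ _
  ...   | inj₂ (c⊀u , u≺c) rewrite c⊀u | u≺c = refl

shareVertex-sym : {n : ℕ} (f g : Fin n × Fin n) → shareVertex f g ≡ shareVertex g f
shareVertex-sym (i , j) (k , l) = begin
    (i == k) ∨ (i == l) ∨ (j == k) ∨ (j == l)
  ≡⟨ swap-middle (i == k) (i == l) (j == k) (j == l) ⟩
    (i == k) ∨ (j == k) ∨ (i == l) ∨ (j == l)
  ≡⟨ cong₂ _∨_ (==-sym i k) (cong₂ _∨_ (==-sym j k) (cong₂ _∨_ (==-sym i l) (==-sym j l))) ⟩
    (k == i) ∨ (k == j) ∨ (l == i) ∨ (l == j) ∎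
  where
  open ≡-Reasoning
  swap-middle : (x y z w : Bool) → (x ∨ (y ∨ (z ∨ w))) ≡ (x ∨ (z ∨ (y ∨ w)))
  swap-middle true y z w = refl
  swap-middle false true true w = refl
  swap-middle false true false w = refl
  swap-middle false false z w = refl

meets : {n : ℕ} → Adj n → (Fin n × Fin n) × (Fin n × Fin n) → ℕ
meets C (f , g) = if isEdge C f then (if isEdge C g then ⟦ shareVertex f g ⟧ else 0) else 0

meets-sym : {n : ℕ} (C : Adj n) (f g : Fin n × Fin n) → meets C (f , g) ≡ meets C (g , f)
meets-sym C f g with isEdge C f | isEdge C g
... | true | true = cong ⟦_⟧ (shareVertex-sym f g)
... | true | false = refl
... | false | true = refl
... | false | false = refl

meets-diag : {n : ℕ} (C : Adj n) (f : Fin n × Fin n) → meets C (f , f) ≡ ⟦ isEdge C f ⟧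
meets-diag C (i , j) with C i j
... | true rewrite ==-refl i = refl
... | false = refl

∑∑ₗ : {n : ℕ} → (Fin n × Fin n → Fin n × Fin n → ℕ) → ℕ
∑∑ₗ {n} F = ∑ₗ (pairs n) (λ f → ∑ₗ (pairs n) (λ g → F f g))

-- An edge meets itself, and every pair of distinct meeting edges is counted twice.
eLine-double-count : {n : ℕ} (C : Adj n) → 2 * eLine C + e C ≡ ∑∑ₗ (λ f g → meets C (f , g))
eLine-double-count {n} C = begin
    2 * eLine C + e C
  ≡⟨ cong₂ (λ u v → 2 * u + v)
       (trans (count≡∑ₗ _ (listPairs (edges C))) (∑ₗ-listPairs-filterᵇ _ (pairs n) _))
       (trans (e-as-∑ₗ C) (∑ₗ-cong (pairs n) (λ f → sym (meets-diag C f)))) ⟩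
    2 * ∑ₗ (listPairs (pairs n)) (meets C) + ∑ₗ (pairs n) (λ f → meets C (f , f))
  ≡⟨ ∑ₗ-listPairs-double (pairs n) (meets C) (meets-sym C) ⟩
    ∑∑ₗ (λ f g → meets C (f , g)) ∎
  where open ≡-Reasoning

∑△ : {n : ℕ} → (Fin n → Fin n → Fin n → ℕ) → ℕ
∑△ F = sum (λ i → sum (λ j → if i ≺ j then sum (λ k → if j ≺ k then F i j k else 0) else 0))

∑△-cong : {n : ℕ} (F G : Fin n → Fin n → Fin n → ℕ) →
  (∀ i j k → (i ≺ j) ≡ true → (j ≺ k) ≡ true → F i j k ≡ G i j k) → ∑△ F ≡ ∑△ G
∑△-cong {n} F G h = sum-cong-≗ {n} (λ i → sum-cong-≗ {n} (λ j → outer i j))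
  where
  outer : ∀ i j → (if i ≺ j then sum (λ k → if j ≺ k then F i j k else 0) else 0)
                ≡ (if i ≺ j then sum (λ k → if j ≺ k then G i j k else 0) else 0)
  outer i j with i ≺ j in i≺j
  ... | false = refl
  ... | true = sum-cong-≗ {n} inner
    where
    inner : ∀ k → (if j ≺ k then F i j k else 0) ≡ (if j ≺ k then G i j k else 0)
    inner k with j ≺ k in j≺k
    ... | false = refl
    ... | true = h i j k i≺j j≺k

∑△-distrib-+ : {n : ℕ} (F G : Fin n → Fin n → Fin n → ℕ) → ∑△ (λ i j k → F i j k + G i j k) ≡ ∑△ F + ∑△ G
∑△-distrib-+ {n} F G =
  trans (sum-cong-≗ {n} (λ i → trans (sum-cong-≗ {n} (λ j →
      trans (cong (λ x → if i ≺ j then x else 0)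
                  (trans (sum-cong-≗ {n} (λ k → if-+ (j ≺ k) _ _)) (∑-distrib-+ {n} _ _)))
            (if-+ (i ≺ j) _ _)))
    (∑-distrib-+ {n} _ _)))
  (∑-distrib-+ {n} _ _)

t-as-∑△ : {n : ℕ} (C : Adj n) → t C ≡ ∑△ (λ i j k → ⟦ C i j ∧ C j k ∧ C i k ⟧)
t-as-∑△ {n} C = trans (count≡∑ₗ _ (triples n)) (∑ₗ-triples n _)

-- Adding an edge

module AddEdge {n : ℕ} (A B : Adj n) (a b : Fin n) (a≺b : (a ≺ b) ≡ true) (a≁b : A a b ≡ false)
  (A-sym : ∀ u v → A u v ≡ A v u) (A-irrefl : ∀ v → A v v ≡ false)
  (B-def : ∀ u v → B u v ≡ (A u v ∨ ((u == a ∧ v == b) ∨ (u == b ∧ v == a)))) where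

  open ≡-Reasoning

  isAB : Fin n × Fin n → Bool
  isAB p = (proj₁ p == a) ∧ (proj₂ p == b)

  ≺⇒not-ba : ∀ u v → (u ≺ v) ≡ true → (u == b ∧ v == a) ≡ false
  ≺⇒not-ba u v u≺v with u ≟ b | v ≟ a
  ... | yes refl | yes refl = ⊥-elim (true≢false (trans (sym u≺v) (≺-asym a b a≺b)))
  ... | yes refl | no _ = refl
  ... | no _ | _ = refl

  B-ordered : ∀ u v → (u ≺ v) ≡ true → B u v ≡ (A u v ∨ isAB (u , v))
  B-ordered u v u≺v rewrite B-def u v | ≺⇒not-ba u v u≺v = cong (A u v ∨_) (∨-identityʳ _)

  if-B : ∀ u v → (u ≺ v) ≡ true → (Y : ℕ) →
    (if B u v then Y else 0) ≡ (if A u v then Y else 0) + (if isAB (u , v) then Y else 0)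
  if-B u v u≺v Y rewrite B-ordered u v u≺v with u ≟ a | v ≟ b
  ... | yes refl | yes refl rewrite a≁b = refl
  ... | yes refl | no _ rewrite ∨-identityʳ (A u v) = sym (+-identityʳ _)
  ... | no _ | _ rewrite ∨-identityʳ (A u v) = sym (+-identityʳ _)

  ∑ₗ-at-ab : (X : Fin n × Fin n → ℕ) → ∑ₗ (pairs n) (λ p → if isAB p then X p else 0) ≡ X (a , b)
  ∑ₗ-at-ab X = begin
      ∑ₗ (pairs n) (λ p → if isAB p then X p else 0)
    ≡⟨ ∑ₗ-pairs n _ ⟩
      sum (λ i → sum (λ j → if i ≺ j then (if (i == a) ∧ (j == b) then X (i , j) else 0) else 0))
    ≡⟨ ∑-single _ a (λ i i≢a → ∑-zero {n} (λ j →
         trans (cong (λ c → if i ≺ j then (if c ∧ (j == b) then X (i , j) else 0) else 0) (≢⇒==-false i≢a)) (if-0 (i ≺ j)))) ⟩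
      sum (λ j → if a ≺ j then (if (a == a) ∧ (j == b) then X (a , j) else 0) else 0)
    ≡⟨ ∑-single _ b (λ j j≢b →
         trans (cong (λ c → if a ≺ j then (if (a == a) ∧ c then X (a , j) else 0) else 0) (≢⇒==-false j≢b))
               (trans (cong (λ c → if a ≺ j then (if c then X (a , j) else 0) else 0) (∧-zeroʳ (a == a))) (if-0 (a ≺ j)))) ⟩
      (if a ≺ b then (if (a == a) ∧ (b == b) then X (a , b) else 0) else 0)
    ≡⟨ cong₃ (λ c d f → if c then (if d ∧ f then X (a , b) else 0) else 0) a≺b (==-refl a) (==-refl b) ⟩
      X (a , b) ∎
    where
    cong₃ : {P Q R S : Set} (f : P → Q → R → S) {x y : P} {u v : Q} {w z : R} → x ≡ y → u ≡ v → w ≡ z → f x u w ≡ f y v z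
    cong₃ f refl refl refl = refl

  e-addEdge : e B ≡ suc (e A)
  e-addEdge = begin
      e B
    ≡⟨ e-as-∑ₗ B ⟩
      ∑ₗ (pairs n) (λ p → ⟦ isEdge B p ⟧)
    ≡⟨ ∑ₗ-pairs-cong n (λ i j i≺j → trans (⟦⟧-as-if (B i j)) (trans (if-B i j i≺j 1) (cong (_+ _) (sym (⟦⟧-as-if (A i j)))))) ⟩
      ∑ₗ (pairs n) (λ p → ⟦ isEdge A p ⟧ + (if isAB p then 1 else 0))
    ≡⟨ ∑ₗ-distrib-+ (pairs n) _ _ ⟩
      ∑ₗ (pairs n) (λ p → ⟦ isEdge A p ⟧) + ∑ₗ (pairs n) (λ p → if isAB p then 1 else 0)
    ≡⟨ cong₂ _+_ (sym (e-as-∑ₗ A)) (∑ₗ-at-ab (λ _ → 1)) ⟩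
      e A + 1
    ≡⟨ +-comm (e A) 1 ⟩
      suc (e A) ∎
    where
    ⟦⟧-as-if : (c : Bool) → ⟦ c ⟧ ≡ (if c then 1 else 0)
    ⟦⟧-as-if true = refl
    ⟦⟧-as-if false = refl

  -- Since ab ∉ A, an edge of A meeting ab contains exactly one of a and b.
  meets-ab : ∀ i j → (i ≺ j) ≡ true →
    (if A i j then ⟦ shareVertex (a , b) (i , j) ⟧ else 0)
      ≡ (⟦ A i j ∧ (i == a) ⟧ + ⟦ A i j ∧ (j == a) ⟧) + (⟦ A i j ∧ (i == b) ⟧ + ⟦ A i j ∧ (j == b) ⟧)
  meets-ab i j i≺j with A i j in Aij
  ... | false = refl
  ... | true rewrite ==-sym a i | ==-sym a j | ==-sym b i | ==-sym b j with i ≟ a | j ≟ a | i ≟ b | j ≟ b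
  ... | yes refl | yes refl | _ | _ = ⊥-elim (≺⇒≢ i i i≺j refl)
  ... | yes refl | no _ | yes refl | _ = ⊥-elim (≺⇒≢ i i a≺b refl)
  ... | yes refl | no _ | no _ | yes refl = ⊥-elim (true≢false (trans (sym Aij) a≁b))
  ... | yes _ | no _ | no _ | no _ = refl
  ... | no _ | yes refl | yes refl | _ = ⊥-elim (true≢false (trans (sym Aij) (trans (A-sym b a) a≁b)))
  ... | no _ | yes refl | no _ | yes refl = ⊥-elim (≺⇒≢ j j a≺b refl)
  ... | no _ | yes _ | no _ | no _ = refl
  ... | no _ | no _ | yes refl | yes refl = ⊥-elim (≺⇒≢ i i i≺j refl)
  ... | no _ | no _ | yes _ | no _ = refl
  ... | no _ | no _ | no _ | yes _ = refl
  ... | no _ | no _ | no _ | no _ = refl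

  edges-meeting-ab : ℕ
  edges-meeting-ab = ∑ₗ (pairs n) (λ g → if isEdge A g then ⟦ shareVertex (a , b) g ⟧ else 0)

  edges-meeting-ab≡ : edges-meeting-ab ≡ deg A a + deg A b
  edges-meeting-ab≡ = begin
      edges-meeting-ab
    ≡⟨ ∑ₗ-pairs-cong n meets-ab ⟩
      ∑ₗ (pairs n) (λ g → incidence a g + incidence b g)
    ≡⟨ ∑ₗ-distrib-+ (pairs n) _ _ ⟩
      ∑ₗ (pairs n) (incidence a) + ∑ₗ (pairs n) (incidence b)
    ≡⟨ sym (cong₂ _+_ (deg-as-∑ₗ A A-sym A-irrefl a) (deg-as-∑ₗ A A-sym A-irrefl b)) ⟩
      deg A a + deg A b ∎
    where
    incidence : Fin n → Fin n × Fin n → ℕ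
    incidence c p = ⟦ isEdge A p ∧ (proj₁ p == c) ⟧ + ⟦ isEdge A p ∧ (proj₂ p == c) ⟧

  ifA ifAB : Fin n × Fin n → ℕ → ℕ
  ifA f Y = if isEdge A f then Y else 0
  ifAB f Y = if isAB f then Y else 0

  shared : Fin n × Fin n → Fin n × Fin n → ℕ
  shared f g = ⟦ shareVertex f g ⟧

  old-new new-old new-new : Fin n × Fin n → Fin n × Fin n → ℕ
  old-new f g = ifA f (ifAB g (shared f g))
  new-old f g = ifAB f (ifA g (shared f g))
  new-new f g = ifAB f (ifAB g (shared f g))

  meets-B : ∀ i j k l → (i ≺ j) ≡ true → (k ≺ l) ≡ true →
    let f = (i , j) ; g = (k , l) in
    meets B (f , g) ≡ (meets A (f , g) + old-new f g) + (new-old f g + new-new f g)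
  meets-B i j k l i≺j k≺l
    rewrite if-B k l k≺l (shared (i , j) (k , l))
          | if-B i j i≺j (ifA (k , l) (shared (i , j) (k , l)) + ifAB (k , l) (shared (i , j) (k , l)))
          | if-+ (A i j) (ifA (k , l) (shared (i , j) (k , l))) (ifAB (k , l) (shared (i , j) (k , l)))
          | if-+ (isAB (i , j)) (ifA (k , l) (shared (i , j) (k , l))) (ifAB (k , l) (shared (i , j) (k , l)))
          = refl

  ∑∑ₗ-old-new : ∑∑ₗ old-new ≡ edges-meeting-ab
  ∑∑ₗ-old-new = ∑ₗ-cong (pairs n) (λ f →
    trans (∑ₗ-if (pairs n) (isEdge A f) (λ g → ifAB g (shared f g)))
          (cong (ifA f) (trans (∑ₗ-at-ab (shared f)) (cong ⟦_⟧ (shareVertex-sym f (a , b))))))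

  ∑∑ₗ-new-old : ∑∑ₗ new-old ≡ edges-meeting-ab
  ∑∑ₗ-new-old = trans (∑ₗ-cong (pairs n) (λ f → ∑ₗ-if (pairs n) (isAB f) (λ g → ifA g (shared f g))))
                      (∑ₗ-at-ab (λ f → ∑ₗ (pairs n) (λ g → ifA g (shared f g))))

  ∑∑ₗ-new-new : ∑∑ₗ new-new ≡ 1
  ∑∑ₗ-new-new = begin
      ∑∑ₗ new-new
    ≡⟨ ∑ₗ-cong (pairs n) (λ f → trans (∑ₗ-if (pairs n) (isAB f) (λ g → ifAB g (shared f g)))
                                     (cong (ifAB f) (∑ₗ-at-ab (shared f)))) ⟩
      ∑ₗ (pairs n) (λ f → ifAB f (shared f (a , b)))
    ≡⟨ ∑ₗ-at-ab (λ f → shared f (a , b)) ⟩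
      ⟦ (a == a) ∨ (a == b) ∨ (b == a) ∨ (b == b) ⟧
    ≡⟨ cong (λ x → ⟦ x ∨ ((a == b) ∨ (b == a) ∨ (b == b)) ⟧) (==-refl a) ⟩
      1 ∎

  ∑∑ₗ-meets-B : ∑∑ₗ (λ f g → meets B (f , g)) ≡ (∑∑ₗ (λ f g → meets A (f , g)) + edges-meeting-ab) + (edges-meeting-ab + 1)
  ∑∑ₗ-meets-B = begin
      ∑∑ₗ (λ f g → meets B (f , g))
    ≡⟨ ∑ₗ-pairs-cong n (λ i j i≺j → ∑ₗ-pairs-cong n (λ k l k≺l → meets-B i j k l i≺j k≺l)) ⟩
      ∑∑ₗ (λ f g → (meets A (f , g) + old-new f g) + (new-old f g + new-new f g))
    ≡⟨ ∑ₗ-cong (pairs n) (λ f → distrib₄ (λ g → meets A (f , g)) (old-new f) (new-old f) (new-new f)) ⟩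
      ∑ₗ (pairs n) (λ f → (∑ₗ (pairs n) (λ g → meets A (f , g)) + ∑ₗ (pairs n) (old-new f))
                        + (∑ₗ (pairs n) (new-old f) + ∑ₗ (pairs n) (new-new f)))
    ≡⟨ distrib₄ _ _ _ _ ⟩
      (∑∑ₗ (λ f g → meets A (f , g)) + ∑∑ₗ old-new) + (∑∑ₗ new-old + ∑∑ₗ new-new)
    ≡⟨ cong₂ (λ u v → (∑∑ₗ (λ f g → meets A (f , g)) + u) + v) ∑∑ₗ-old-new (cong₂ _+_ ∑∑ₗ-new-old ∑∑ₗ-new-new) ⟩
      (∑∑ₗ (λ f g → meets A (f , g)) + edges-meeting-ab) + (edges-meeting-ab + 1) ∎
    where
    distrib₄ : (w x y z : Fin n × Fin n → ℕ) →
      ∑ₗ (pairs n) (λ f → (w f + x f) + (y f + z f)) ≡ (∑ₗ (pairs n) w + ∑ₗ (pairs n) x) + (∑ₗ (pairs n) y + ∑ₗ (pairs n) z)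
    distrib₄ w x y z = trans (∑ₗ-distrib-+ (pairs n) _ _) (cong₂ _+_ (∑ₗ-distrib-+ (pairs n) w x) (∑ₗ-distrib-+ (pairs n) y z))

  eLine-addEdge : eLine B ≡ eLine A + (deg A a + deg A b)
  eLine-addEdge = *-cancelˡ-≡ _ _ 2 (+-cancelʳ-≡ (e B) _ _ (begin
      2 * eLine B + e B
    ≡⟨ eLine-double-count B ⟩
      ∑∑ₗ (λ f g → meets B (f , g))
    ≡⟨ ∑∑ₗ-meets-B ⟩
      (∑∑ₗ (λ f g → meets A (f , g)) + edges-meeting-ab) + (edges-meeting-ab + 1)
    ≡⟨ cong (λ x → (x + edges-meeting-ab) + (edges-meeting-ab + 1)) (sym (eLine-double-count A)) ⟩
      ((2 * eLine A + e A) + edges-meeting-ab) + (edges-meeting-ab + 1)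
    ≡⟨ regroup (eLine A) (e A) edges-meeting-ab ⟩
      2 * (eLine A + edges-meeting-ab) + suc (e A)
    ≡⟨ cong₂ (λ x y → 2 * (eLine A + x) + y) edges-meeting-ab≡ (sym e-addEdge) ⟩
      2 * (eLine A + (deg A a + deg A b)) + e B ∎))
    where
    regroup : ∀ x y d → ((2 * x + y) + d) + (d + 1) ≡ 2 * (x + d) + suc y
    regroup = solve-∀

  commonNbr : Fin n → Bool
  commonNbr w = A a w ∧ A b w

  ab-at-ij ab-at-jk ab-at-ik : Fin n → Fin n → Fin n → ℕ
  ab-at-ij i j k = if i == a then (if j == b then ⟦ commonNbr k ⟧ else 0) else 0
  ab-at-jk i j k = if j == a then (if k == b then ⟦ commonNbr i ⟧ else 0) else 0
  ab-at-ik i j k = if i == a then (if k == b then ⟦ commonNbr j ⟧ else 0) else 0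

  no-ab : (x y z : Bool) → ⟦ (x ∨ false) ∧ (y ∨ false) ∧ (z ∨ false) ⟧ ≡ ⟦ x ∧ y ∧ z ⟧ + (0 + (0 + 0))
  no-ab x y z rewrite ∨-identityʳ x | ∨-identityʳ y | ∨-identityʳ z = sym (+-identityʳ _)

  ab-as-side-ik : (x y : Bool) → ⟦ x ∧ y ∧ true ⟧ ≡ ⟦ x ∧ y ∧ false ⟧ + (0 + (0 + ⟦ x ∧ y ⟧))
  ab-as-side-ik true true = refl
  ab-as-side-ik true false = refl
  ab-as-side-ik false y = refl

  ab-as-side-jk : (x y : Bool) → ⟦ x ∧ true ∧ y ⟧ ≡ ⟦ x ∧ false ∧ y ⟧ + (0 + (⟦ x ∧ y ⟧ + 0))
  ab-as-side-jk true true = refl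
  ab-as-side-jk true false = refl
  ab-as-side-jk false y = refl

  -- A triangle i ≺ j ≺ k of B is a triangle of A, or uses the new edge ab as one of its three sides.
  triangle-B : ∀ i j k → (i ≺ j) ≡ true → (j ≺ k) ≡ true →
    ⟦ B i j ∧ B j k ∧ B i k ⟧ ≡ ⟦ A i j ∧ A j k ∧ A i k ⟧ + (ab-at-ij i j k + (ab-at-jk i j k + ab-at-ik i j k))
  triangle-B i j k i≺j j≺k
    rewrite B-ordered i j i≺j | B-ordered j k j≺k | B-ordered i k (≺-trans i j k i≺j j≺k)
    with i ≟ a | j ≟ b | j ≟ a | k ≟ b
  ... | yes _ | yes refl | yes refl | _ = ⊥-elim (≺⇒≢ j j a≺b refl)
  ... | yes _ | yes refl | no _ | yes refl = ⊥-elim (≺⇒≢ j j j≺k refl)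
  ... | yes refl | yes refl | no _ | no _
      rewrite a≁b | ∨-identityʳ (A j k) | ∨-identityʳ (A i k) = trans (cong ⟦_⟧ (∧-comm (A j k) (A i k))) (sym (+-identityʳ _))
  ... | yes refl | no _ | yes refl | _ = ⊥-elim (≺⇒≢ i i i≺j refl)
  ... | yes refl | no _ | no _ | yes refl
      rewrite a≁b | ∨-identityʳ (A i j) | ∨-identityʳ (A j k) | A-sym j k = ab-as-side-ik (A i j) (A k j)
  ... | yes _ | no _ | no _ | no _ = no-ab (A i j) (A j k) (A i k)
  ... | no _ | yes refl | yes refl | _ = ⊥-elim (≺⇒≢ j j a≺b refl)
  ... | no _ | yes refl | no _ | yes refl = ⊥-elim (≺⇒≢ j j j≺k refl)
  ... | no _ | yes _ | no _ | no _ = no-ab (A i j) (A j k) (A i k)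
  ... | no _ | no _ | yes refl | yes refl
      rewrite a≁b | ∨-identityʳ (A i j) | ∨-identityʳ (A i k) | A-sym i j | A-sym i k = ab-as-side-jk (A j i) (A k i)
  ... | no _ | no _ | yes _ | no _ = no-ab (A i j) (A j k) (A i k)
  ... | no _ | no _ | no _ | yes _ = no-ab (A i j) (A j k) (A i k)
  ... | no _ | no _ | no _ | no _ = no-ab (A i j) (A j k) (A i k)

  ∑-below : (i : Fin n) (F : Fin n → Fin n → ℕ) → (∀ j k → F j k ≡ 0) →
    sum (λ j → if i ≺ j then sum (λ k → if j ≺ k then F j k else 0) else 0) ≡ 0
  ∑-below i F h = ∑-zero {n} (λ j → trans (cong (λ x → if i ≺ j then x else 0)
    (∑-zero {n} (λ k → trans (cong (λ x → if j ≺ k then x else 0) (h j k)) (if-0 (j ≺ k))))) (if-0 (i ≺ j)))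

  above-b below-a between-a-b : Fin n → ℕ
  above-b w = if b ≺ w then ⟦ commonNbr w ⟧ else 0
  below-a w = if w ≺ a then ⟦ commonNbr w ⟧ else 0
  between-a-b w = if a ≺ w then (if w ≺ b then ⟦ commonNbr w ⟧ else 0) else 0

  ∑△-ab-at-ij : ∑△ ab-at-ij ≡ sum above-b
  ∑△-ab-at-ij = begin
      ∑△ ab-at-ij
    ≡⟨ ∑-single _ a (λ i i≢a → ∑-below i (ab-at-ij i)
         (λ j k → cong (λ c → if c then (if j == b then ⟦ commonNbr k ⟧ else 0) else 0) (≢⇒==-false i≢a))) ⟩
      sum (λ j → if a ≺ j then sum (λ k → if j ≺ k then ab-at-ij a j k else 0) else 0)
    ≡⟨ ∑-single _ b (λ j j≢b → trans (cong (λ x → if a ≺ j then x else 0) (∑-zero {n} (λ k →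
         trans (cong (λ x → if j ≺ k then x else 0)
                     (cong₂ (λ c d → if c then (if d then ⟦ commonNbr k ⟧ else 0) else 0) (==-refl a) (≢⇒==-false j≢b)))
               (if-0 (j ≺ k))))) (if-0 (a ≺ j))) ⟩
      (if a ≺ b then sum (λ k → if b ≺ k then ab-at-ij a b k else 0) else 0)
    ≡⟨ cong₂ (λ c x → if c then x else 0) a≺b (sum-cong-≗ {n} (λ k → cong (λ x → if b ≺ k then x else 0)
         (cong₂ (λ c d → if c then (if d then ⟦ commonNbr k ⟧ else 0) else 0) (==-refl a) (==-refl b)))) ⟩
      sum (λ k → if b ≺ k then ⟦ commonNbr k ⟧ else 0) ∎

  ∑△-ab-at-jk : ∑△ ab-at-jk ≡ sum below-a
  ∑△-ab-at-jk = sum-cong-≗ {n} (λ i → begin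
      sum (λ j → if i ≺ j then sum (λ k → if j ≺ k then ab-at-jk i j k else 0) else 0)
    ≡⟨ sum-cong-≗ {n} (λ j → cong (λ x → if i ≺ j then x else 0) (∑-single _ b (λ k k≢b →
         trans (cong (λ x → if j ≺ k then x else 0)
                     (trans (cong (λ d → if j == a then (if d then ⟦ commonNbr i ⟧ else 0) else 0) (≢⇒==-false k≢b)) (if-0 (j == a))))
               (if-0 (j ≺ k))))) ⟩
      sum (λ j → if i ≺ j then (if j ≺ b then ab-at-jk i j b else 0) else 0)
    ≡⟨ ∑-single _ a (λ j j≢a → trans (cong (λ x → if i ≺ j then x else 0)
         (trans (cong (λ x → if j ≺ b then x else 0)
                      (cong (λ c → if c then (if b == b then ⟦ commonNbr i ⟧ else 0) else 0) (≢⇒==-false j≢a)))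
                (if-0 (j ≺ b)))) (if-0 (i ≺ j))) ⟩
      (if i ≺ a then (if a ≺ b then ab-at-jk i a b else 0) else 0)
    ≡⟨ cong (λ x → if i ≺ a then x else 0) (cong₂ (λ c x → if c then x else 0) a≺b
         (cong₂ (λ c d → if c then (if d then ⟦ commonNbr i ⟧ else 0) else 0) (==-refl a) (==-refl b))) ⟩
      (if i ≺ a then ⟦ commonNbr i ⟧ else 0) ∎)

  ∑△-ab-at-ik : ∑△ ab-at-ik ≡ sum between-a-b
  ∑△-ab-at-ik = begin
      ∑△ ab-at-ik
    ≡⟨ ∑-single _ a (λ i i≢a → ∑-below i (ab-at-ik i)
         (λ j k → cong (λ c → if c then (if k == b then ⟦ commonNbr j ⟧ else 0) else 0) (≢⇒==-false i≢a))) ⟩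
      sum (λ j → if a ≺ j then sum (λ k → if j ≺ k then ab-at-ik a j k else 0) else 0)
    ≡⟨ sum-cong-≗ {n} (λ j → cong (λ x → if a ≺ j then x else 0) (∑-single _ b (λ k k≢b →
         trans (cong (λ x → if j ≺ k then x else 0)
                     (cong₂ (λ c d → if c then (if d then ⟦ commonNbr j ⟧ else 0) else 0) (==-refl a) (≢⇒==-false k≢b)))
               (if-0 (j ≺ k))))) ⟩
      sum (λ j → if a ≺ j then (if j ≺ b then ab-at-ik a j b else 0) else 0)
    ≡⟨ sum-cong-≗ {n} (λ j → cong (λ x → if a ≺ j then x else 0) (cong (λ x → if j ≺ b then x else 0)
         (cong₂ (λ c d → if c then (if d then ⟦ commonNbr j ⟧ else 0) else 0) (==-refl a) (==-refl b)))) ⟩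
      sum (λ j → if a ≺ j then (if j ≺ b then ⟦ commonNbr j ⟧ else 0) else 0) ∎

  -- a and b are not common neighbours, and every other vertex lies below a, between a and b, or above b.
  common-nbr-split : ∀ w → above-b w + (below-a w + between-a-b w) ≡ ⟦ commonNbr w ⟧
  common-nbr-split w with w ≟ a | w ≟ b
  ... | yes refl | _ rewrite A-irrefl w | ≺-irrefl w | ≺-asym w b a≺b = refl
  ... | no _ | yes refl rewrite a≁b | ≺-irrefl w | ≺-asym a w a≺b = if-0 (a ≺ w)
  ... | no w≢a | no w≢b with ≺-total w a w≢a | ≺-total w b w≢b
  ... | inj₁ (w≺a , _) | inj₂ (_ , b≺w) = ⊥-elim (true≢false (trans (sym (≺-trans b w a b≺w w≺a)) (≺-asym a b a≺b)))
  ... | inj₁ (w≺a , a⊀w) | inj₁ (_ , b⊀w) rewrite b⊀w | w≺a | a⊀w = +-identityʳ _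
  ... | inj₂ (w⊀a , a≺w) | inj₁ (w≺b , b⊀w) rewrite b⊀w | w⊀a | a≺w | w≺b = refl
  ... | inj₂ (w⊀a , a≺w) | inj₂ (w⊀b , b≺w) rewrite b≺w | w⊀a | a≺w | w⊀b = +-identityʳ _

  t-addEdge : t B ≡ t A + count commonNbr (allFin n)
  t-addEdge = begin
      t B
    ≡⟨ t-as-∑△ B ⟩
      ∑△ (λ i j k → ⟦ B i j ∧ B j k ∧ B i k ⟧)
    ≡⟨ ∑△-cong {n} _ _ triangle-B ⟩
      ∑△ (λ i j k → ⟦ A i j ∧ A j k ∧ A i k ⟧ + (ab-at-ij i j k + (ab-at-jk i j k + ab-at-ik i j k)))
    ≡⟨ ∑△-distrib-+ {n} _ _ ⟩
      ∑△ (λ i j k → ⟦ A i j ∧ A j k ∧ A i k ⟧) + ∑△ (λ i j k → ab-at-ij i j k + (ab-at-jk i j k + ab-at-ik i j k))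
    ≡⟨ cong₂ _+_ (sym (t-as-∑△ A)) (trans (∑△-distrib-+ {n} _ _) (cong (∑△ ab-at-ij +_) (∑△-distrib-+ {n} _ _))) ⟩
      t A + (∑△ ab-at-ij + (∑△ ab-at-jk + ∑△ ab-at-ik))
    ≡⟨ cong (t A +_) (cong₂ _+_ ∑△-ab-at-ij (cong₂ _+_ ∑△-ab-at-jk ∑△-ab-at-ik)) ⟩
      t A + (sum above-b + (sum below-a + sum between-a-b))
    ≡⟨ cong (t A +_) (trans (cong (sum above-b +_) (sym (∑-distrib-+ {n} below-a between-a-b))) (sym (∑-distrib-+ {n} _ _))) ⟩
      t A + sum (λ w → above-b w + (below-a w + between-a-b w))
    ≡⟨ cong (t A +_) (trans (sum-cong-≗ {n} common-nbr-split) (sym (count-allFin n commonNbr))) ⟩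
      t A + count commonNbr (allFin n) ∎

φ-change : {n : ℕ} (H H′ : Adj n) {d c : ℕ} →
  e (compl H′) ≡ suc (e (compl H)) → eLine (compl H′) ≡ eLine (compl H) + d → t (compl H′) ≡ t (compl H) + c →
  φ H′ ≡ φ H - ((ℤ.+ (n ∸ 3) - ℤ.+ d) ℤ.+ ℤ.+ c)
φ-change {n} H H′ {d} {c} e′ eLine′ t′
  rewrite e′ | eLine′ | t′ | ℤ.pos-+ 1 (e (compl H)) | ℤ.pos-+ (eLine (compl H)) d | ℤ.pos-+ (t (compl H)) c
  = φ-shape (ℤ.+ (n choose 3)) (ℤ.+ (n ∸ 3)) (ℤ.+ e (compl H)) (ℤ.+ eLine (compl H)) (ℤ.+ t (compl H)) (ℤ.+ d) (ℤ.+ c)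
  where
  φ-shape : ∀ (b s x l y d w : ℤ.ℤ) →
    ((b - s ℤ.* (ℤ.+ 1 ℤ.+ x)) ℤ.+ (l ℤ.+ d)) - (y ℤ.+ w) ≡ (((b - s ℤ.* x) ℤ.+ l) - y) - ((s - d) ℤ.+ w)
  φ-shape = ℤ-Solver.solve-∀

φ-removeEdge : {n : ℕ} (H H′ : Adj n) (a b : Fin n) (a≺b : (a ≺ b) ≡ true) (a≁b : compl H a b ≡ false)
  (sym-H̄ : ∀ u v → compl H u v ≡ compl H v u) (irrefl-H̄ : ∀ v → compl H v v ≡ false)
  (H̄′-def : ∀ u v → compl H′ u v ≡ (compl H u v ∨ ((u == a ∧ v == b) ∨ (u == b ∧ v == a)))) →
  φ H′ ≡ φ H - ((ℤ.+ (n ∸ 3) - ℤ.+ (deg (compl H) a + deg (compl H) b))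
                ℤ.+ ℤ.+ count (λ w → compl H a w ∧ compl H b w) (allFin n))
φ-removeEdge H H′ a b a≺b a≁b sym-H̄ irrefl-H̄ H̄′-def = φ-change H H′ e-addEdge eLine-addEdge t-addEdge
  where open AddEdge (compl H) (compl H′) a b a≺b a≁b sym-H̄ irrefl-H̄ H̄′-def

-- Properly labeled starters

compl-sym : {n : ℕ} (A : Adj n) → (∀ u v → A u v ≡ A v u) → ∀ u v → compl A u v ≡ compl A v u
compl-sym A A-sym u v = cong₂ (λ x y → not x ∧ not y) (A-sym u v) (==-sym u v)

compl-irrefl : {n : ℕ} (A : Adj n) → ∀ v → compl A v v ≡ false
compl-irrefl A v rewrite ==-refl v = ∧-zeroʳ (not (A v v))

Gl-sym : {n : ℕ} (G : Adj n) → (∀ u v → G u v ≡ G v u) → ∀ l u v → Gl G l u v ≡ Gl G l v u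
Gl-sym {n} G G-sym l u v = cong₂ (λ x y → x ∧ not y) (G-sym u v) (∨-comm (delIdx n l (toℕ u) (toℕ v)) _)

-- Vertex indices are labels minus one: the vertex labelled n is top, with index n′ = n - 1.
module ProperlyLabeled (k : ℕ) (G : Adj (6 + k)) (simple : IsSimple G) (e-Ḡ : e (compl G) ≡ m (6 + k))
  (top-isolated : ∀ (v : Fin (6 + k)) → toℕ v ≡ 5 + k → deg (compl G) v ≡ 0)
  (leaf-order : ∀ (i : ℕ) → 1 ≤ i → i ≤ m (6 + k) → ∀ (v : Fin (6 + k)) → toℕ v ≡ (6 + k) ∸ i ∸ 1 →
    degBelow (compl G) ((6 + k) ∸ i ∸ 1 + 1) v ≡ 1) where

  n n′ M : ℕ
  n = 6 + k
  n′ = 5 + k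
  M = m n

  F : Adj n
  F = compl G

  G-sym : ∀ u v → G u v ≡ G v u
  G-sym = IsSimple.symm simple

  G-irrefl : ∀ v → G v v ≡ false
  G-irrefl = IsSimple.irrefl simple

  F-sym : ∀ u v → F u v ≡ F v u
  F-sym = compl-sym G G-sym

  F-irrefl : ∀ v → F v v ≡ false
  F-irrefl = compl-irrefl G

  M≤2+k : M ≤ 2 + k
  M≤2+k = s≤s (s≤s (⌈n/2⌉≤n k))

  M≤n′ : M ≤ n′
  M≤n′ = ≤-trans M≤2+k (m≤n+m (2 + k) 3)

  3≤n′∸M : 3 ≤ n′ ∸ M
  3≤n′∸M = subst (3 ≤_) (sym (+-∸-assoc 3 (⌈n/2⌉≤n k))) (s≤s (s≤s (s≤s z≤n)))

  top : Fin n
  top = fromℕ n′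

  toℕ-top : toℕ top ≡ n′
  toℕ-top = toℕ-fromℕ n′

  F-top : ∀ u → F top u ≡ false
  F-top u = ⟦⟧≡0⇒false (F top u)
    (∑≡0⇒≡0 (λ u → ⟦ F top u ⟧) (trans (sym (count-allFin n (F top))) (top-isolated top toℕ-top)) u)

  lowerDeg : Fin n → ℕ
  lowerDeg v = sum (λ u → ⟦ F v u ∧ (u ≺ v) ⟧)

  degBelow-lowerDeg : ∀ v → degBelow F (toℕ v + 1) v ≡ lowerDeg v
  degBelow-lowerDeg v = trans (count-allFin n (λ u → F v u ∧ (toℕ u <ᵇ toℕ v + 1))) (sum-cong-≗ {n} below-v)
    where
    below-v : ∀ u → ⟦ F v u ∧ (toℕ u <ᵇ toℕ v + 1) ⟧ ≡ ⟦ F v u ∧ (u ≺ v) ⟧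
    below-v u with u ≟ v
    ... | yes refl rewrite F-irrefl u = refl
    ... | no u≢v rewrite +-comm (toℕ v) 1 | <ᵇ-suc (toℕ u) (toℕ v) | ≤ᵇ-≢ (λ e → u≢v (toℕ-injective e)) = refl

  -- Counting each edge at its upper endpoint.
  e-lowerDeg : e F ≡ sum lowerDeg
  e-lowerDeg = begin
      e F
    ≡⟨ e-as-∑ₗ F ⟩
      ∑ₗ (pairs n) (λ p → ⟦ isEdge F p ⟧)
    ≡⟨ ∑ₗ-pairs n (λ p → ⟦ isEdge F p ⟧) ⟩
      sum (λ i → sum (λ j → if i ≺ j then ⟦ F i j ⟧ else 0))
    ≡⟨ ∑-comm {n} {n} (λ i j → if i ≺ j then ⟦ F i j ⟧ else 0) ⟩
      sum (λ j → sum (λ i → if i ≺ j then ⟦ F i j ⟧ else 0))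
    ≡⟨ sum-cong-≗ {n} (λ j → sum-cong-≗ {n} (λ i → as-∧ i j)) ⟩
      sum lowerDeg ∎
    where
    open ≡-Reasoning
    as-∧ : ∀ i j → (if i ≺ j then ⟦ F i j ⟧ else 0) ≡ ⟦ F j i ∧ (i ≺ j) ⟧
    as-∧ i j rewrite F-sym i j with i ≺ j
    ... | true rewrite ∧-identityʳ (F j i) = refl
    ... | false rewrite ∧-zeroʳ (F j i) = refl

  -- The vertices labelled n - M, …, n - 1, i.e. those whose lower degree the labelling fixes to be 1.
  inWindow : Fin n → Bool
  inWindow j = ((n′ ∸ M) ≤ᵇ toℕ j) ∧ (toℕ j <ᵇ n′)

  inWindow⇒ : ∀ j → inWindow j ≡ true → (n′ ∸ M ≤ toℕ j) × (toℕ j < n′)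
  inWindow⇒ j j∈W with ∧-true⇒ {(n′ ∸ M) ≤ᵇ toℕ j} {toℕ j <ᵇ n′} j∈W
  ... | lo , hi = ≤ᵇ-sound lo , <ᵇ-sound hi

  lowerDeg-inWindow : ∀ j → inWindow j ≡ true → lowerDeg j ≡ 1
  lowerDeg-inWindow j j∈W = begin
      lowerDeg j
    ≡⟨ sym (degBelow-lowerDeg j) ⟩
      degBelow F (toℕ j + 1) j
    ≡⟨ cong (λ x → degBelow F (x + 1) j) j≡n∸i∸1 ⟩
      degBelow F (n ∸ i ∸ 1 + 1) j
    ≡⟨ leaf-order i (m<n⇒0<n∸m j<n′) i≤M j j≡n∸i∸1 ⟩
      1 ∎
    where
    open ≡-Reasoning
    i = n′ ∸ toℕ j
    j<n′ : toℕ j < n′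
    j<n′ = proj₂ (inWindow⇒ j j∈W)
    i≤M : i ≤ M
    i≤M = ≤-trans (∸-monoʳ-≤ n′ (proj₁ (inWindow⇒ j j∈W))) (≤-reflexive (m∸[m∸n]≡n M≤n′))
    j≡n∸i∸1 : toℕ j ≡ n ∸ i ∸ 1
    j≡n∸i∸1 = sym (trans (cong (_∸ 1) (+-∸-assoc 1 (m∸n≤m n′ (toℕ j)))) (m∸[m∸n]≡n (<⇒≤ j<n′)))

  ∑-inWindow : sum (λ j → ⟦ inWindow j ⟧) ≡ M
  ∑-inWindow = trans (∑-interval n (n′ ∸ M) n′ (n≤1+n n′)) (m∸[m∸n]≡n M≤n′)

  -- The window already accounts for all e F = M edges, so every other lower degree vanishes.
  lowerDeg-outWindow : ∀ j → inWindow j ≡ false → lowerDeg j ≡ 0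
  lowerDeg-outWindow j j∉W = subst (λ c → (if c then 0 else lowerDeg j) ≡ 0) j∉W (∑≡0⇒≡0 outside ∑-outside j)
    where
    outside : Fin n → ℕ
    outside j = if inWindow j then 0 else lowerDeg j
    split : ∀ j → lowerDeg j ≡ ⟦ inWindow j ⟧ + outside j
    split j with inWindow j in j∈W
    ... | true = lowerDeg-inWindow j j∈W
    ... | false = refl
    ∑-outside : sum outside ≡ 0
    ∑-outside = +-cancelˡ-≡ M _ _ (begin
        M + sum outside
      ≡⟨ cong (_+ sum outside) (sym ∑-inWindow) ⟩
        sum (λ j → ⟦ inWindow j ⟧) + sum outside
      ≡⟨ sym (∑-distrib-+ {n} (λ j → ⟦ inWindow j ⟧) outside) ⟩
        sum (λ j → ⟦ inWindow j ⟧ + outside j)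
      ≡⟨ sym (sum-cong-≗ {n} split) ⟩
        sum lowerDeg
      ≡⟨ sym e-lowerDeg ⟩
        e F
      ≡⟨ e-Ḡ ⟩
        M
      ≡⟨ sym (+-identityʳ M) ⟩
        M + 0 ∎)
      where open ≡-Reasoning

  lowerDeg≤1 : ∀ j → lowerDeg j ≤ 1
  lowerDeg≤1 j with inWindow j in j∈W
  ... | true = ≤-reflexive (lowerDeg-inWindow j j∈W)
  ... | false = subst (_≤ 1) (sym (lowerDeg-outWindow j j∈W)) z≤n

  upper-end-in-window : ∀ i j → F i j ≡ true → (i ≺ j) ≡ true → inWindow j ≡ true
  upper-end-in-window i j Fij i≺j with inWindow j in j∈W
  ... | true = refl
  ... | false = ⊥-elim (1+n≰n (subst (1 ≤_) (lowerDeg-outWindow j j∈W)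
                  (subst (_≤ lowerDeg j) i-counted (≤-∑ (λ u → ⟦ F j u ∧ (u ≺ j) ⟧) i))))
    where
    i-counted : ⟦ F j i ∧ (i ≺ j) ⟧ ≡ 1
    i-counted rewrite F-sym j i | Fij | i≺j = refl

  upper-end-≥3 : ∀ i j → F i j ≡ true → (i ≺ j) ≡ true → 3 ≤ toℕ j
  upper-end-≥3 i j Fij i≺j = ≤-trans 3≤n′∸M (proj₁ (inWindow⇒ j (upper-end-in-window i j Fij i≺j)))

  unique-lower-nbr : ∀ j i₁ i₂ → F j i₁ ≡ true → F j i₂ ≡ true → (i₁ ≺ j) ≡ true → (i₂ ≺ j) ≡ true → i₁ ≡ i₂
  unique-lower-nbr j i₁ i₂ F₁ F₂ i₁≺j i₂≺j with i₁ ≟ i₂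
  ... | yes i₁≡i₂ = i₁≡i₂
  ... | no i₁≢i₂ = ⊥-elim (1+n≰n (≤-trans
        (subst (_≤ lowerDeg j) (cong₂ _+_ (counted i₁ F₁ i₁≺j) (counted i₂ F₂ i₂≺j)) (+≤-∑ (λ u → ⟦ F j u ∧ (u ≺ j) ⟧) i₁≢i₂))
        (lowerDeg≤1 j)))
    where
    counted : ∀ i → F j i ≡ true → (i ≺ j) ≡ true → ⟦ F j i ∧ (i ≺ j) ⟧ ≡ 1
    counted i Fji i≺j rewrite Fji | i≺j = refl

  G-true : ∀ u w → u ≢ w → F u w ≡ false → G u w ≡ true
  G-true u w u≢w Fuw with G u w
  ... | true = refl
  ... | false = ⊥-elim (true≢false (trans (cong (λ c → true ∧ not c) (sym (≢⇒==-false u≢w))) Fuw))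

  Gl-away-from-top : ∀ l u w → toℕ u ≢ n′ → toℕ w ≢ n′ → Gl G l u w ≡ G u w
  Gl-away-from-top l u w u≢top w≢top rewrite ≡ᵇ-false u≢top | ≡ᵇ-false w≢top = ∧-identityʳ (G u w)

  top≢ : ∀ w → toℕ w < n′ → top ≢ w
  top≢ w w<n′ top≡w = <-irrefl (sym (trans (sym toℕ-top) (cong toℕ top≡w))) w<n′

  <n′∸l⇒<n′ : ∀ {x} l → x < n′ ∸ l → x < n′
  <n′∸l⇒<n′ l x<n′∸l = <-≤-trans x<n′∸l (m∸n≤m n′ l)

  Gl-top : ∀ l (w : Fin n) → toℕ w < n′ ∸ l → Gl G l top w ≡ true
  Gl-top l w w<n′∸l
    rewrite toℕ-fromℕ k | ≡ᵇ-refl k | ≤ᵇ-false (<⇒≱ w<n′∸l) | ≡ᵇ-false (<⇒≢ (<n′∸l⇒<n′ l w<n′∸l))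
          | G-true top w (top≢ w (<n′∸l⇒<n′ l w<n′∸l)) (F-top w) = refl

  Gl-top-deleted : ∀ l (v : Fin n) → ¬ toℕ v < n′ ∸ l → toℕ v < n′ → Gl G l top v ≡ false
  Gl-top-deleted l v v≮n′∸l v<n′ rewrite toℕ-fromℕ k | ≡ᵇ-refl k | ≤ᵇ-true (≮⇒≥ v≮n′∸l) | <ᵇ-true v<n′ = ∧-zeroʳ (G top v)

  Gl-top⇒ : ∀ l (v : Fin n) → Gl G l top v ≡ true → toℕ v < n′ ∸ l
  Gl-top⇒ l v h with toℕ v <? (n′ ∸ l)
  ... | yes v<n′∸l = v<n′∸l
  ... | no v≮n′∸l with v ≟ top
  ...   | yes refl = ⊥-elim (true≢false (trans (sym h) (cong (_∧ _) (G-irrefl v))))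
  ...   | no v≢top = ⊥-elim (true≢false (trans (sym h) (Gl-top-deleted l v v≮n′∸l v<n′)))
    where
    v<n′ : toℕ v < n′
    v<n′ = ≤∧≢⇒< (ℕ.s≤s⁻¹ (toℕ<n v)) (λ e → v≢top (toℕ-injective (trans e (sym toℕ-top))))

  -- w is excluded as a common neighbour of an edge at x
  blocks : Fin n → Fin n → Bool
  blocks x w = (x == w) ∨ F x w

  blocks⇒F : ∀ x w → blocks x w ≡ true → x ≢ w → F x w ≡ true
  blocks⇒F x w h x≢w rewrite ≢⇒==-false x≢w = h

  unblocked⇒ : ∀ x w → blocks x w ≡ false → (x ≢ w) × (F x w ≡ false)
  unblocked⇒ x w h with x ≟ w
  ... | yes refl = ⊥-elim (true≢false h)
  ... | no x≢w = x≢w , h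

  unblocked⇒G : ∀ x w → blocks x w ≡ false → G x w ≡ true
  unblocked⇒G x w h = G-true x w (proj₁ (unblocked⇒ x w h)) (proj₂ (unblocked⇒ x w h))

  -- F-edges have their upper end at index ≥ 3, and each vertex has at most one lower F-neighbour.
  blocks-at-most-one : ∀ x w₁ w₂ → toℕ w₁ < toℕ w₂ → toℕ w₂ ≤ 2 → blocks x w₁ ≡ true → blocks x w₂ ≡ true → ⊥
  blocks-at-most-one x w₁ w₂ w₁<w₂ w₂≤2 b₁ b₂ = cases (x ≟ w₁) (x ≟ w₂)
    where
    cases : Dec (x ≡ w₁) → Dec (x ≡ w₂) → ⊥
    cases (yes x≡w₁) (yes x≡w₂) = <-irrefl (cong toℕ (trans (sym x≡w₁) x≡w₂)) w₁<w₂
    cases (yes refl) (no x≢w₂) = <⇒≱ (s≤s w₂≤2) (upper-end-≥3 x w₂ (blocks⇒F x w₂ b₂ x≢w₂) (<⇒≺ x w₂ w₁<w₂))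
    cases (no x≢w₁) (yes refl) =
      <⇒≱ (s≤s w₂≤2) (upper-end-≥3 w₁ x (trans (F-sym w₁ x) (blocks⇒F x w₁ b₁ x≢w₁)) (<⇒≺ w₁ x w₁<w₂))
    cases (no x≢w₁) (no x≢w₂) with <-cmp (toℕ x) (toℕ w₂)
    ... | tri< x<w₂ _ _ = <⇒≱ (s≤s w₂≤2) (upper-end-≥3 x w₂ (blocks⇒F x w₂ b₂ x≢w₂) (<⇒≺ x w₂ x<w₂))
    ... | tri≈ _ x≡w₂ _ = x≢w₂ (toℕ-injective x≡w₂)
    ... | tri> _ _ w₂<x = <-irrefl (cong toℕ (unique-lower-nbr x w₁ w₂ (blocks⇒F x w₁ b₁ x≢w₁) (blocks⇒F x w₂ b₂ x≢w₂)
                            (<⇒≺ w₁ x (<-trans w₁<w₂ w₂<x)) (<⇒≺ w₂ x w₂<x))) w₁<w₂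

  v₀ v₁ v₂ : Fin n
  v₀ = fzero
  v₁ = fsuc fzero
  v₂ = fsuc (fsuc fzero)

  unblocked-for-one : ∀ x → Σ (Fin n) λ w → (toℕ w ≤ 1) × (blocks x w ≡ false)
  unblocked-for-one x with blocks x v₀ in b₀ | blocks x v₁ in b₁
  ... | false | _ = v₀ , z≤n , b₀
  ... | true | false = v₁ , ≤-refl , b₁
  ... | true | true = ⊥-elim (blocks-at-most-one x v₀ v₁ (s≤s z≤n) (s≤s z≤n) b₀ b₁)

  unblocked-for-two-if-v₀ : ∀ x y → blocks x v₀ ≡ true → Σ (Fin n) λ w → (toℕ w ≤ 2) × (blocks x w ≡ false) × (blocks y w ≡ false)
  unblocked-for-two-if-v₀ x y bx₀ with blocks x v₁ in bx₁ | blocks y v₁ in by₁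
  ... | true | _ = ⊥-elim (blocks-at-most-one x v₀ v₁ (s≤s z≤n) (s≤s z≤n) bx₀ bx₁)
  ... | false | false = v₁ , s≤s z≤n , bx₁ , by₁
  ... | false | true with blocks x v₂ in bx₂ | blocks y v₂ in by₂
  ...   | true | _ = ⊥-elim (blocks-at-most-one x v₀ v₂ (s≤s z≤n) ≤-refl bx₀ bx₂)
  ...   | false | true = ⊥-elim (blocks-at-most-one y v₁ v₂ (s≤s (s≤s z≤n)) ≤-refl by₁ by₂)
  ...   | false | false = v₂ , ≤-refl , bx₂ , by₂

  unblocked-for-two : ∀ x y → Σ (Fin n) λ w → (toℕ w ≤ 2) × (blocks x w ≡ false) × (blocks y w ≡ false)
  unblocked-for-two x y with blocks x v₀ in bx₀ | blocks y v₀ in by₀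
  ... | false | false = v₀ , z≤n , bx₀ , by₀
  ... | true | _ = unblocked-for-two-if-v₀ x y bx₀
  ... | false | true with unblocked-for-two-if-v₀ y x by₀
  ...   | w , w≤2 , byw , bxw = w , w≤2 , bxw , byw

  small≢top : ∀ (w : Fin n) → toℕ w ≤ 2 → toℕ w ≢ n′
  small≢top w w≤2 w≡n′ with subst (_≤ 2) w≡n′ w≤2
  ... | s≤s (s≤s ())

  triangle-at-top : ∀ l → 2 ≤ n′ ∸ l → ∀ v → Gl G l top v ≡ true →
    Σ (Fin n) λ w → (Gl G l top w ≡ true) × (Gl G l v w ≡ true)
  triangle-at-top l 2≤n′∸l v top~v with unblocked-for-one v
  ... | w , w≤1 , v-free =
      w , Gl-top l w (<-≤-trans (s≤s w≤1) 2≤n′∸l)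
        , trans (Gl-away-from-top l v w (<⇒≢ (<n′∸l⇒<n′ l (Gl-top⇒ l v top~v))) (small≢top w (≤-trans w≤1 (n≤1+n 1))))
                (unblocked⇒G v w v-free)

  triangle-away-from-top : ∀ l u v → toℕ u ≢ n′ → toℕ v ≢ n′ →
    Σ (Fin n) λ w → (Gl G l u w ≡ true) × (Gl G l v w ≡ true)
  triangle-away-from-top l u v u≢top v≢top with unblocked-for-two u v
  ... | w , w≤2 , u-free , v-free =
      w , trans (Gl-away-from-top l u w u≢top (small≢top w w≤2)) (unblocked⇒G u w u-free)
        , trans (Gl-away-from-top l v w v≢top (small≢top w w≤2)) (unblocked⇒G v w v-free)

  Gl-isTGraph : ∀ l → l ≤ n ∸ 3 → IsTGraph (Gl G l)
  Gl-isTGraph l l≤n∸3 = is-T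
    where
    2≤n′∸l : 2 ≤ n′ ∸ l
    2≤n′∸l = ≤-trans (≤-reflexive (sym (m+n∸n≡m 2 k))) (∸-monoʳ-≤ n′ l≤n∸3)
    is-T : IsTGraph (Gl G l)
    is-T u v u~v with toℕ u ℕ.≟ n′ | toℕ v ℕ.≟ n′
    ... | yes u≡n′ | _ with toℕ-injective {i = u} {j = top} (trans u≡n′ (sym toℕ-top))
    ...   | refl = triangle-at-top l 2≤n′∸l v u~v
    is-T u v u~v | no _ | yes v≡n′ with toℕ-injective {i = v} {j = top} (trans v≡n′ (sym toℕ-top))
    ...   | refl with triangle-at-top l 2≤n′∸l u (trans (Gl-sym G G-sym l top u) u~v)
    ...     | w , top~w , u~w = w , u~w , top~w
    is-T u v u~v | no u≢top | no v≢top = triangle-away-from-top l u v u≢top v≢top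

  -- Passing from G_l′ to G_(l′+1) deletes the edge between top and the vertex q with index c = n′ - (l′ + 1).
  module Step (l′ : ℕ) (l′<n′ : l′ < n′) where

    c : ℕ
    c = n′ ∸ suc l′

    n′∸l′ : n′ ∸ l′ ≡ suc c
    n′∸l′ = +-∸-assoc 1 l′<n′

    c<n′ : c < n′
    c<n′ = ∸-monoʳ-< {n′} {suc l′} {0} (s≤s z≤n) l′<n′

    q : Fin n
    q = fromℕ< (m<n⇒m<1+n c<n′)

    toℕ-q : toℕ q ≡ c
    toℕ-q = toℕ-fromℕ< (m<n⇒m<1+n c<n′)

    A B : Adj n
    A = compl (Gl G l′)
    B = compl (Gl G (suc l′))

    c≤ᵇ-split : ∀ y → ((c ≤ᵇ y) ∧ (y <ᵇ n′)) ≡ (((suc c ≤ᵇ y) ∧ (y <ᵇ n′)) ∨ (y ≡ᵇ c))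
    c≤ᵇ-split y with <-cmp y c
    ... | tri< y<c _ _ rewrite ≤ᵇ-false (<⇒≱ y<c) | ≤ᵇ-false (λ c<y → <⇒≱ y<c (≤-trans (n≤1+n c) c<y)) | ≡ᵇ-false (<⇒≢ y<c) = refl
    ... | tri≈ _ refl _ rewrite ≤ᵇ-true (≤-refl {y}) | ≤ᵇ-false (n≮n y) | ≡ᵇ-refl y | <ᵇ-true c<n′ = refl
    ... | tri> _ _ c<y rewrite ≤ᵇ-true (<⇒≤ c<y) | ≤ᵇ-true c<y | ≡ᵇ-false (≢-sym (<⇒≢ c<y)) = sym (∨-identityʳ _)

    delIdx-step : ∀ x y → delIdx n (suc l′) x y ≡ (delIdx n l′ x y ∨ ((x ≡ᵇ n′) ∧ (y ≡ᵇ c)))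
    delIdx-step x y rewrite n′∸l′ = trans (cong ((x ≡ᵇ n′) ∧_) (c≤ᵇ-split y)) (∧-distribˡ-∨ (x ≡ᵇ n′) _ _)

    deleted-step : ∀ u v → (delIdx n (suc l′) (toℕ u) (toℕ v) ∨ delIdx n (suc l′) (toℕ v) (toℕ u)) ≡
      ((delIdx n l′ (toℕ u) (toℕ v) ∨ delIdx n l′ (toℕ v) (toℕ u)) ∨ (((u == q) ∧ (v == top)) ∨ ((u == top) ∧ (v == q))))
    deleted-step u v
      rewrite delIdx-step (toℕ u) (toℕ v) | delIdx-step (toℕ v) (toℕ u)
            | ==-toℕ u q | ==-toℕ v top | ==-toℕ u top | ==-toℕ v q | toℕ-q | toℕ-top
      = trans (interchange (delIdx n l′ (toℕ u) (toℕ v)) _ (delIdx n l′ (toℕ v) (toℕ u)) _)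
              (cong (λ z → (delIdx n l′ (toℕ u) (toℕ v) ∨ delIdx n l′ (toℕ v) (toℕ u)) ∨ (z ∨ ((toℕ u ≡ᵇ n′) ∧ (toℕ v ≡ᵇ c))))
                    (∧-comm (toℕ v ≡ᵇ n′) (toℕ u ≡ᵇ c)))
      where
      interchange : (x y z w : Bool) → ((x ∨ y) ∨ (z ∨ w)) ≡ ((x ∨ z) ∨ (w ∨ y))
      interchange true y z w = refl
      interchange false true true w = refl
      interchange false true false true = refl
      interchange false true false false = refl
      interchange false false true w = refl
      interchange false false false w = sym (∨-identityʳ w)

    q≢top : q ≢ top
    q≢top q≡top = <-irrefl (trans (sym toℕ-q) (trans (cong toℕ q≡top) toℕ-top)) c<n′

    edge-q-top : Fin n → Fin n → Bool
    edge-q-top u v = ((u == q) ∧ (v == top)) ∨ ((u == top) ∧ (v == q))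

    edge-q-top⇒≢ : ∀ u v → edge-q-top u v ≡ true → not (u == v) ≡ true
    edge-q-top⇒≢ u v h with u ≟ v
    ... | no _ = refl
    ... | yes refl with (u == q) ∧ (u == top) in e₁ | (u == top) ∧ (u == q) in e₂
    ...   | true | _ = ⊥-elim (q≢top (trans (sym (==-true⇒≡ (proj₁ (∧-true⇒ {u == q} e₁)))) (==-true⇒≡ (proj₂ (∧-true⇒ {u == q} e₁)))))
    ...   | false | true = ⊥-elim (q≢top (trans (sym (==-true⇒≡ (proj₂ (∧-true⇒ {u == top} e₂)))) (==-true⇒≡ (proj₁ (∧-true⇒ {u == top} e₂)))))
    ...   | false | false = ⊥-elim (true≢false (sym h))

    B-def : ∀ u v → B u v ≡ (A u v ∨ edge-q-top u v)
    B-def u v rewrite deleted-step u v = compl-deleted (G u v) _ (edge-q-top u v) (not (u == v)) (edge-q-top⇒≢ u v)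
      where
      compl-deleted : ∀ g d x z → (x ≡ true → z ≡ true) → (not (g ∧ not (d ∨ x)) ∧ z) ≡ ((not (g ∧ not d) ∧ z) ∨ x)
      compl-deleted g d true z x⇒z rewrite x⇒z refl | ∨-zeroʳ d | ∧-zeroʳ g = sym (∨-zeroʳ _)
      compl-deleted g d false z _ rewrite ∨-identityʳ d = sym (∨-identityʳ _)

    c≢n′ : c ≢ n′
    c≢n′ = <⇒≢ c<n′

    q≺top : (q ≺ top) ≡ true
    q≺top = <⇒≺ q top (subst₂ _<_ (sym toℕ-q) (sym toℕ-top) c<n′)

    q≁top : A q top ≡ false
    q≁top rewrite toℕ-q | toℕ-fromℕ k | ≡ᵇ-false c≢n′ | ≡ᵇ-refl k | n′∸l′ | ≤ᵇ-false (n≮n c)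
                | G-true q top q≢top (trans (F-sym q top) (F-top q)) = refl

    -- In A, top is adjacent exactly to the vertices whose edges to top are already deleted.
    A-top : ∀ u → A top u ≡ ((suc c ≤ᵇ toℕ u) ∧ (toℕ u <ᵇ n′))
    A-top u with u ≟ top
    ... | yes refl rewrite toℕ-fromℕ k | ==-refl u | n<ᵇn k = trans (∧-zeroʳ _) (sym (∧-zeroʳ _))
    ... | no u≢top rewrite ≢⇒==-false (≢-sym u≢top) | toℕ-fromℕ k | ≡ᵇ-refl k | n′∸l′
                         | ≡ᵇ-false (λ (e : toℕ u ≡ n′) → u≢top (toℕ-injective (trans e (sym toℕ-top))))
                         | G-true top u (≢-sym u≢top) (F-top u) = simplify ((suc c ≤ᵇ toℕ u) ∧ (toℕ u <ᵇ n′))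
      where
      simplify : ∀ r → (not (true ∧ not (r ∨ false)) ∧ true) ≡ r
      simplify true = refl
      simplify false = refl

    A-q : ∀ u → A q u ≡ F q u
    A-q u rewrite toℕ-q | ≡ᵇ-false c≢n′ | n′∸l′ | ≤ᵇ-false (n≮n c) | ∧-zeroʳ (toℕ u ≡ᵇ n′) | ∧-identityʳ (G q u) = refl

    deg-top : deg A top ≡ l′
    deg-top = begin
        deg A top
      ≡⟨ count-allFin n (A top) ⟩
        sum (λ u → ⟦ A top u ⟧)
      ≡⟨ sum-cong-≗ {n} (λ u → cong ⟦_⟧ (A-top u)) ⟩
        sum (λ (u : Fin n) → ⟦ (suc c ≤ᵇ toℕ u) ∧ (toℕ u <ᵇ n′) ⟧)
      ≡⟨ ∑-interval n (suc c) n′ (n≤1+n n′) ⟩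
        n′ ∸ suc c
      ≡⟨ cong (n′ ∸_) (sym n′∸l′) ⟩
        n′ ∸ (n′ ∸ l′)
      ≡⟨ m∸[m∸n]≡n (<⇒≤ l′<n′) ⟩
        l′ ∎
      where open ≡-Reasoning

    commonNbrs : ℕ
    commonNbrs = count (λ w → A q w ∧ A top w) (allFin n)

    -- The A-neighbours of q are its lower F-neighbour (if any) and upper F-neighbours, which all lie strictly between q and top.
    deg-q : deg A q ≡ lowerDeg q + commonNbrs
    deg-q = begin
        deg A q
      ≡⟨ count-allFin n (A q) ⟩
        sum (λ u → ⟦ A q u ⟧)
      ≡⟨ sum-cong-≗ {n} split ⟩
        sum (λ u → ⟦ F q u ∧ (u ≺ q) ⟧ + ⟦ A q u ∧ A top u ⟧)
      ≡⟨ ∑-distrib-+ {n} (λ u → ⟦ F q u ∧ (u ≺ q) ⟧) (λ u → ⟦ A q u ∧ A top u ⟧) ⟩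
        lowerDeg q + sum (λ u → ⟦ A q u ∧ A top u ⟧)
      ≡⟨ cong (lowerDeg q +_) (sym (count-allFin n (λ u → A q u ∧ A top u))) ⟩
        lowerDeg q + commonNbrs ∎
      where
      open ≡-Reasoning
      split : ∀ u → ⟦ A q u ⟧ ≡ ⟦ F q u ∧ (u ≺ q) ⟧ + ⟦ A q u ∧ A top u ⟧
      split u rewrite A-q u | A-top u with F q u in Fqu
      ... | false = refl
      ... | true with u ≟ top | u ≟ q
      ...   | yes refl | _ = ⊥-elim (true≢false (trans (sym Fqu) (trans (F-sym q u) (F-top q))))
      ...   | no _ | yes refl = ⊥-elim (true≢false (trans (sym Fqu) (F-irrefl u)))
      ...   | no u≢top | no u≢q with <-cmp (toℕ u) c
      ...     | tri≈ _ u≡c _ = ⊥-elim (u≢q (toℕ-injective (trans u≡c (sym toℕ-q))))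
      ...     | tri< u<c _ _ rewrite toℕ-q | <ᵇ-true u<c | ≤ᵇ-false (λ c<u → <⇒≱ u<c (≤-trans (n≤1+n c) c<u)) = refl
      ...     | tri> _ _ c<u rewrite toℕ-q | <ᵇ-false (<-asym c<u) | ≤ᵇ-true c<u
                 | <ᵇ-true (≤∧≢⇒< (ℕ.s≤s⁻¹ (toℕ<n u)) (λ e → u≢top (toℕ-injective (trans e (sym toℕ-top))))) = refl

    φ-step : φ (Gl G (suc l′)) ≡ φ (Gl G l′) - ((ℤ.+ (n ∸ 3) - ℤ.+ lowerDeg q) - ℤ.+ l′)
    φ-step = begin
        φ (Gl G (suc l′))
      ≡⟨ φ-removeEdge (Gl G l′) (Gl G (suc l′)) q top q≺top q≁top
           (compl-sym (Gl G l′) (Gl-sym G G-sym l′)) (compl-irrefl (Gl G l′)) B-def ⟩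
        φ (Gl G l′) - ((ℤ.+ (n ∸ 3) - ℤ.+ (deg A q + deg A top)) ℤ.+ ℤ.+ commonNbrs)
      ≡⟨ cong (λ d → φ (Gl G l′) - ((ℤ.+ (n ∸ 3) - ℤ.+ d) ℤ.+ ℤ.+ commonNbrs)) (cong₂ _+_ deg-q deg-top) ⟩
        φ (Gl G l′) - ((ℤ.+ (n ∸ 3) - ℤ.+ ((lowerDeg q + commonNbrs) + l′)) ℤ.+ ℤ.+ commonNbrs)
      ≡⟨ cong (φ (Gl G l′) -_) (cancel-commonNbrs (n ∸ 3) (lowerDeg q) commonNbrs l′) ⟩
        φ (Gl G l′) - ((ℤ.+ (n ∸ 3) - ℤ.+ lowerDeg q) - ℤ.+ l′) ∎
      where
      open ≡-Reasoning
      cancel-commonNbrs : ∀ s x y z → (ℤ.+ s - ℤ.+ ((x + y) + z)) ℤ.+ ℤ.+ y ≡ (ℤ.+ s - ℤ.+ x) - ℤ.+ z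
      cancel-commonNbrs s x y z rewrite ℤ.pos-+ (x + y) z | ℤ.pos-+ x y = shape (ℤ.+ s) (ℤ.+ x) (ℤ.+ y) (ℤ.+ z)
        where
        shape : ∀ (s x y z : ℤ.ℤ) → (s - ((x ℤ.+ y) ℤ.+ z)) ℤ.+ y ≡ (s - x) - z
        shape = ℤ-Solver.solve-∀

  α-shape : ∀ l′ a d → a ≡ 2 + d → (ℤ.+ n - ℤ.+ suc l′) - ℤ.+ a ≡ (ℤ.+ (n ∸ 3) - ℤ.+ d) - ℤ.+ l′
  α-shape l′ a d refl rewrite ℤ.pos-+ 6 k | ℤ.pos-+ 1 l′ | ℤ.pos-+ 3 k | ℤ.pos-+ 2 d = shape (ℤ.+ k) (ℤ.+ l′) (ℤ.+ d)
    where
    shape : ∀ (k l d : ℤ.ℤ) → ((ℤ.+ 6 ℤ.+ k) - (ℤ.+ 1 ℤ.+ l)) - (ℤ.+ 2 ℤ.+ d) ≡ ((ℤ.+ 3 ℤ.+ k) - d) - l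
    shape = ℤ-Solver.solve-∀

  α-via-lowerDeg : ∀ l′ (l′<n′ : l′ < n′) → α n (suc l′) ≡ (ℤ.+ (n ∸ 3) - ℤ.+ lowerDeg (Step.q l′ l′<n′)) - ℤ.+ l′
  α-via-lowerDeg l′ l′<n′ with suc l′ ℕ.≤ᵇ M in l≤ᵇM
  ... | true = trans (α-shape l′ 3 1 refl) (cong (λ d → (ℤ.+ (n ∸ 3) - ℤ.+ d) - ℤ.+ l′) (sym (lowerDeg-inWindow q q∈W)))
    where
    open Step l′ l′<n′ using (q; toℕ-q; c<n′)
    q∈W : inWindow q ≡ true
    q∈W rewrite toℕ-q | ≤ᵇ-true (∸-monoʳ-≤ n′ (≤ᵇ-sound {suc l′} {M} l≤ᵇM)) | <ᵇ-true c<n′ = refl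
  ... | false = trans (α-shape l′ 2 0 refl) (cong (λ d → (ℤ.+ (n ∸ 3) - ℤ.+ d) - ℤ.+ l′) (sym (lowerDeg-outWindow q q∉W)))
    where
    open Step l′ l′<n′ using (q; toℕ-q)
    q∉W : inWindow q ≡ false
    q∉W rewrite toℕ-q | ≤ᵇ-false {n′ ∸ M} {n′ ∸ suc l′} (<⇒≱ (∸-monoʳ-< {n′} {suc l′} {M} (≰⇒> (λ l≤M → true≢false (trans (sym (≤ᵇ-true l≤M)) l≤ᵇM))) l′<n′)) = refl

  φ-recurrence : ∀ l → 1 ≤ l → l ≤ n ∸ 1 → φ (Gl G l) ≡ φ (Gl G (l ∸ 1)) - α n l
  φ-recurrence (suc l′) _ l′<n′ = trans (Step.φ-step l′ l′<n′) (cong (φ (Gl G l′) -_) (sym (α-via-lowerDeg l′ l′<n′)))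

lemma3p13 : (n : ℕ) → 6 ≤ n → (G : Adj n) → IsProperlyLabeled G →
    ((l : ℕ) → 1 ≤ l → l ≤ n ∸ 1 → φ (Gl G l) ≡ φ (Gl G (l ∸ 1)) - α n l)
    × ((l : ℕ) → 1 ≤ l → l ≤ n ∸ 3 → IsTGraph (Gl G l))
lemma3p13 (suc (suc (suc (suc (suc (suc k)))))) (s≤s (s≤s (s≤s (s≤s (s≤s (s≤s z≤n)))))) G ((simple , _ , e-Ḡ) , top-isolated , leaf-order) =
  φ-recurrence , λ l _ → Gl-isTGraph l
  where open ProperlyLabeled k G simple e-Ḡ top-isolated leaf-order
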